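{- Let $k\ge1$. The generating function $G^{(k)}(x,p)$ defined in the context satisfies \[ G^{(k)}(x,p)=1+px\prod_{j=0}^{k}G^{(k)}(p^{j}x,p) \] as formal power series in $x$.
   Context: A heap of pieces (Viennot) over a set $P$ with a symmetric reflexive "concurrency" relation $\mathcal R$ is a finite poset $(E,\le)$ with a labelling $\epsilon:E\to P$ such that: - (A1) if $\epsilon(\alpha)\,\mathcal R\,\epsilon(\beta)$, then $\alpha$ and $\beta$ are comparable; - (A2) if $\beta$ covers $\alpha$, then $\epsilon(\alpha)\,\mathcal R\,\epsilon(\beta)$. Heaps are considered up to isomorphism of labelled posets. Maximal elements are called maximal pieces. Here the pieces are integer segments $[c,c+k]$ with $c\ge1$, and two segments are concurrent iff they intersect; $c$ is the left abscissa of the piece. $G^{(k)}(x,p)=\sum_H x^{\#\text{pieces of }H}\,p^{\sum(\text{left abscissae of pieces of }H)}$. The sum runs over all such heaps $H$ that have a unique maximal piece whose left abscissa is $1$, together with the empty heap, which contributes $1$. -}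

module Defs where

open import Data.Nat using (ℕ; zero; suc; _+_; _*_; _∸_; _≤_; _≤?_)
open import Data.Fin as F using (Fin)
open import Data.Bool using (Bool; true)
open import Data.List using (List; length; lookup)
open import Data.List.Relation.Unary.All using (All)
open import Data.Product using (Σ; _×_)
open import Data.Sum using (_⊎_)
open import Relation.Binary.PropositionalEquality using (_≡_; _≢_)
open import Relation.Nullary using (yes; no)
open import Function.Bundles using (_↔_; Inverse)

∑Fin : (n : ℕ) → (Fin n → ℕ) → ℕ
∑Fin zero    f = 0
∑Fin (suc n) f = f F.zero + ∑Fin n (λ i → f (F.suc i))

sumTo : ℕ → (ℕ → ℕ) → ℕ
sumTo zero    f = f 0
sumTo (suc n) f = sumTo n f + f (suc n)

-- two segments [a,a+k], [b,b+k] intersect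
Conc : ℕ → ℕ → ℕ → Set
Conc k a b = (a ≤ b + k) × (b ≤ a + k)

-- a labelled finite poset on n elements: labels are left abscissae,
-- the order relation is given as a (decidable) Bool-valued relation
record LPoset (n : ℕ) : Set where
  field
    lab : Fin n → ℕ
    le  : Fin n → Fin n → Bool
open LPoset public

module _ {n : ℕ} (h : LPoset n) where
  Covers : Fin n → Fin n → Set
  Covers a b = (le h a b ≡ true) × (a ≢ b)
             × (∀ g → le h a g ≡ true → le h g b ≡ true → (g ≡ a) ⊎ (g ≡ b))

  Maximal : Fin n → Set
  Maximal a = ∀ b → le h a b ≡ true → b ≡ a

  weight : ℕ
  weight = ∑Fin n (lab h)

record IsHeap (k : ℕ) {n : ℕ} (h : LPoset n) : Set where
  field
    lab≥1   : ∀ a → 1 ≤ lab h a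
    refl≤   : ∀ a → le h a a ≡ true
    antisym : ∀ a b → le h a b ≡ true → le h b a ≡ true → a ≡ b
    trans≤  : ∀ a b c → le h a b ≡ true → le h b c ≡ true → le h a c ≡ true
    A1      : ∀ a b → Conc k (lab h a) (lab h b) → (le h a b ≡ true) ⊎ (le h b a ≡ true)
    A2      : ∀ a b → Covers h a b → Conc k (lab h a) (lab h b)

Counted : {n : ℕ} → LPoset n → Set
Counted {n} h = (n ≡ 0) ⊎ Σ (Fin n) λ a → Maximal h a × (lab h a ≡ 1) × (∀ b → Maximal h b → b ≡ a)

Iso : {n : ℕ} → LPoset n → LPoset n → Set
Iso {n} h h' = Σ (Fin n ↔ Fin n) λ f →
  (∀ a → lab h' (Inverse.to f a) ≡ lab h a) ×
  (∀ a b → le h' (Inverse.to f a) (Inverse.to f b) ≡ le h a b)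

RepSystem : (k n m : ℕ) → List (LPoset n) → Set
RepSystem k n m L =
  All (λ h → IsHeap k h × Counted h × (weight h ≡ m)) L ×
  (∀ i j → Iso (lookup L i) (lookup L j) → i ≡ j) ×
  (∀ (h : LPoset n) → IsHeap k h → Counted h → weight h ≡ m →
     Σ (Fin (length L)) λ i → Iso h (lookup L i))

-- Formal power series in x, p with ℕ coefficients:
-- F n m = coefficient of x^n p^m

FPS : Set
FPS = ℕ → ℕ → ℕ

oneS : FPS
oneS zero zero = 1
oneS _    _    = 0

_⊕_ : FPS → FPS → FPS
(f ⊕ g) n m = f n m + g n m

_⊗_ : FPS → FPS → FPS
(f ⊗ g) n m = sumTo n λ a → sumTo m λ b → f a b * g (n ∸ a) (m ∸ b)

-- multiplication by p x
pxS : FPS → FPS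
pxS f (suc n) (suc m) = f n m
pxS f _       _       = 0

-- substitution x ↦ p^j x
scaleS : ℕ → FPS → FPS
scaleS j f n m with j * n ≤? m
... | yes _ = f n (m ∸ j * n)
... | no  _ = 0

prodS : ℕ → (ℕ → FPS) → FPS
prodS zero    F = F 0
prodS (suc k) F = prodS k F ⊗ F (suc k)

IsGenFun : ℕ → FPS → Set
IsGenFun k G = ∀ n m → Σ (List (LPoset n)) λ L → RepSystem k n m L × (length L ≡ G n m)

{-# OPTIONS --safe #-}
module Submission where

-- A heap all of whose maximal pieces have left abscissa at most r + 1 splits uniquely into the
-- downset D of pieces lying below some piece of abscissa at most r, a heap of the same kind for r,
-- and the remaining pieces, which lie above D, have abscissae greater than r, and whose maximal
-- pieces all sit at r + 1; being pairwise concurrent these form one pyramid, shifted by r.  Hence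
-- ∏_{j=0}^{k} G(p^j x) counts the heaps with maxima at most k + 1, which are exactly what remains
-- of a nonempty pyramid after removing its top piece [1, 1 + k]: G = 1 + p x ∏_{j=0}^{k} G(p^j x).
-- The decomposition is carried out on explicit lists of canonical words (a heap is encoded by the
-- word of its abscissae read from the top), so that list lengths multiply like coefficients.

open import Defs

open import Data.Bool using (Bool; true; false; _∧_; _∨_)
open import Data.Bool.Properties using (∧-conicalˡ; ∧-conicalʳ; ∨-zeroʳ; ¬-not)
import Data.Bool.Properties as Bool
open import Data.Empty using (⊥)
open import Data.Fin as Fin using (Fin; zero; suc; punchIn; punchOut)
open import Data.Fin.Properties using (suc-injective; any?; cast-involutive; cantor-schröder-bernstein)
open import Data.Fin.Properties using (punchIn-injective; punchInᵢ≢i; punchIn-punchOut; punchOut-cong; punchOut-punchIn)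
open import Data.List using (List; []; _∷_; _++_; length; lookup; map; tabulate)
open import Data.List.Properties using (length-++; length-map; length-tabulate; lookup-tabulate)
open import Data.List.Properties using (∷-injective; ∷-injectiveʳ; ++-cancelʳ; map-injective; map-id; map-∘; map-id-local)
open import Data.List.Membership.Propositional using (_∈_)
open import Data.List.Membership.Propositional.Properties using (∈-lookup; ∈-++⁻; ∈-++⁺ˡ; ∈-++⁺ʳ; ∈-map⁻; ∈-map⁺)
open import Data.List.Relation.Unary.All as All using (All; []; _∷_)
import Data.List.Relation.Unary.All.Properties as All
open import Data.List.Relation.Unary.Any as Any using (here; there)
open import Data.List.Relation.Unary.Any.Properties using (lookup-index)
open import Data.List.Relation.Unary.Unique.Propositional using (Unique; []; _∷_)
import Data.List.Relation.Unary.Unique.Propositional.Properties as Unique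
open import Data.Nat using (ℕ; zero; suc; _+_; _*_; _∸_; _≤_; _<_; _≤?_; z≤n; s≤s)
open import Data.Nat.ListAction using (sum)
open import Data.Nat.ListAction.Properties using (sum-++)
import Data.Nat.Properties as ℕ
open import Data.Nat.Properties using (≤-refl; ≤-trans; ≤-antisym; ≤-reflexive; <-irrefl; ≤-<-trans; <-≤-trans; <⇒≤; <⇒≱; ≰⇒>)
open import Data.Nat.Properties using (n≤1+n; m≤n⇒m≤1+n; m≤n⇒m<n∨m≡n; m≤m+n; m≤n+m; m∸n≤m; m<n⇒0<n∸m)
open import Data.Nat.Properties using (+-comm; +-assoc; *-zeroʳ; +-monoʳ-≤; +-cancelˡ-≤; +-cancelˡ-≡)
open import Data.Nat.Properties using (m+[n∸m]≡n; m∸n+n≡m; m+n∸n≡m; m+n∸m≡n; +-commutativeSemigroup)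
open import Algebra.Properties.CommutativeSemigroup +-commutativeSemigroup using (x∙yz≈y∙xz)
open import Data.Nat.Tactic.RingSolver using (solve-∀)
open import Data.Product using (Σ; ∃; ∃-syntax; _×_; _,_; proj₁; proj₂; swap)
import Data.Product as Product
open import Data.Sum using (_⊎_; inj₁; inj₂)
import Data.Sum as Sum
open import Data.Unit using (⊤; tt)
open import Function using (_∘_; id)
open import Function.Bundles using (Inverse; mk↔ₛ′)
open import Relation.Binary.PropositionalEquality
open import Relation.Nullary using (Dec; yes; no; does; contradiction)
open import Relation.Nullary.Decidable using (_×-dec_; ¬?; dec-true)
open import Relation.Unary using (Decidable)

false≢true : false ≢ true
false≢true ()

∨-true⁻ : ∀ a {b} → a ∨ b ≡ true → a ≡ true ⊎ b ≡ true
∨-true⁻ true  _ = inj₁ refl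
∨-true⁻ false p = inj₂ p

Bool-ext : ∀ {a b : Bool} → (a ≡ true → b ≡ true) → (b ≡ true → a ≡ true) → a ≡ b
Bool-ext {true}  {true}  _ _ = refl
Bool-ext {true}  {false} f _ = sym (f refl)
Bool-ext {false} {true}  _ g = g refl
Bool-ext {false} {false} _ _ = refl

does⇒ : ∀ {p} {P : Set p} (p? : Dec P) → does p? ≡ true → P
does⇒ (yes p) _ = p

anyᶠ : ∀ n → (Fin n → Bool) → Bool
anyᶠ zero    f = false
anyᶠ (suc n) f = f zero ∨ anyᶠ n (f ∘ suc)

anyᶠ-intro : ∀ {n} (f : Fin n → Bool) i → f i ≡ true → anyᶠ n f ≡ true
anyᶠ-intro f zero    p = cong (_∨ anyᶠ _ (f ∘ suc)) p
anyᶠ-intro f (suc i) p = trans (cong (f zero ∨_) (anyᶠ-intro (f ∘ suc) i p)) (∨-zeroʳ (f zero))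

anyᶠ-elim : ∀ {n} (f : Fin n → Bool) → anyᶠ n f ≡ true → ∃[ i ] f i ≡ true
anyᶠ-elim {suc n} f p with ∨-true⁻ (f zero) p
... | inj₁ q = zero , q
... | inj₂ q with anyᶠ-elim (f ∘ suc) q
...   | i , r = suc i , r

module _ {n : ℕ} (R : Fin n → Fin n → Bool) (P : Fin n → Set) where

  MaximalIn : Fin n → Set
  MaximalIn a = P a × (∀ g → P g → R a g ≡ true → g ≡ a)

maximalIn-exists : ∀ {n} (R : Fin n → Fin n → Bool) →
  (∀ a b → R a b ≡ true → R b a ≡ true → a ≡ b) →
  (∀ a b c → R a b ≡ true → R b c ≡ true → R a c ≡ true) →
  {P : Fin n → Set} → Decidable P → ∀ x → P x → ∃ (MaximalIn R P)
maximalIn-exists {suc n} R R-antisym R-trans {P} P? x Px with any? (P? ∘ suc)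
... | no ¬P∘suc = zero , P0 x Px , zero-max
  where
    P0 : ∀ x → P x → P zero
    P0 zero    Px = Px
    P0 (suc x) Px = contradiction (x , Px) ¬P∘suc
    zero-max : ∀ g → P g → R zero g ≡ true → g ≡ zero
    zero-max zero    _  _ = refl
    zero-max (suc g) Pg _ = contradiction (g , Pg) ¬P∘suc
... | yes (x′ , Px′)
  with maximalIn-exists (λ i j → R (suc i) (suc j)) (λ a b p q → suc-injective (R-antisym _ _ p q))
         (λ a b c → R-trans _ _ _) (P? ∘ suc) x′ Px′
...   | a , Pa , a-max with P? zero ×-dec (R (suc a) zero Bool.≟ true)
...     | yes (P0 , a≤0) = zero , P0 , zero-max
  where
    zero-max : ∀ g → P g → R zero g ≡ true → g ≡ zero
    zero-max zero    _  _   = refl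
    zero-max (suc g) Pg 0≤g with a-max g Pg (R-trans (suc a) zero (suc g) a≤0 0≤g)
    ... | refl = contradiction (R-antisym _ _ 0≤g a≤0) λ ()
...     | no ¬P0×a≤0 = suc a , Pa , suc-max
  where
    suc-max : ∀ g → P g → R (suc a) g ≡ true → g ≡ suc a
    suc-max zero    P0 a≤0 = contradiction (P0 , a≤0) ¬P0×a≤0
    suc-max (suc g) Pg a≤g = cong suc (a-max g Pg a≤g)

module _ {A : Set} where

  inL : ∀ (u v : List A) → Fin (length u) → Fin (length (u ++ v))
  inL (c ∷ u) v zero    = zero
  inL (c ∷ u) v (suc i) = suc (inL u v i)

  inR : ∀ (u v : List A) → Fin (length v) → Fin (length (u ++ v))
  inR []      v j = j
  inR (c ∷ u) v j = suc (inR u v j)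

  data Side++ (u v : List A) : Fin (length (u ++ v)) → Set where
    left  : ∀ i → Side++ u v (inL u v i)
    right : ∀ j → Side++ u v (inR u v j)

  side++ : ∀ u v x → Side++ u v x
  side++ []      v x       = right x
  side++ (c ∷ u) v zero    = left zero
  side++ (c ∷ u) v (suc x) with side++ u v x
  ... | left i  = left (suc i)
  ... | right j = right j

  inL≢inR : ∀ u v i j → inL u v i ≢ inR u v j
  inL≢inR (c ∷ u) v zero    j ()
  inL≢inR (c ∷ u) v (suc i) j e = inL≢inR u v i j (suc-injective e)

  inL-injective : ∀ u v {i i′} → inL u v i ≡ inL u v i′ → i ≡ i′
  inL-injective (c ∷ u) v {zero}  {zero}   e = refl
  inL-injective (c ∷ u) v {suc i} {suc i′} e = cong suc (inL-injective u v (suc-injective e))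

  inR-injective : ∀ u v {j j′} → inR u v j ≡ inR u v j′ → j ≡ j′
  inR-injective []      v e = e
  inR-injective (c ∷ u) v e = inR-injective u v (suc-injective e)

  lookup-inL : ∀ u v i → lookup (u ++ v) (inL u v i) ≡ lookup u i
  lookup-inL (c ∷ u) v zero    = refl
  lookup-inL (c ∷ u) v (suc i) = lookup-inL u v i

  lookup-inR : ∀ u v j → lookup (u ++ v) (inR u v j) ≡ lookup v j
  lookup-inR []      v j = refl
  lookup-inR (c ∷ u) v j = lookup-inR u v j

  inL-or-inR : ∀ u v x → (∃[ i ] x ≡ inL u v i) ⊎ (∃[ j ] x ≡ inR u v j)
  inL-or-inR u v x with side++ u v x
  ... | left i  = inj₁ (i , refl)
  ... | right j = inj₂ (j , refl)

  map++ : ∀ (u v u′ v′ : List A) → (Fin (length u) → Fin (length u′)) → (Fin (length v) → Fin (length v′)) →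
    Fin (length (u ++ v)) → Fin (length (u′ ++ v′))
  map++ []      v u′ v′ f g x       = inR u′ v′ (g x)
  map++ (c ∷ u) v u′ v′ f g zero    = inL u′ v′ (f zero)
  map++ (c ∷ u) v u′ v′ f g (suc x) = map++ u v u′ v′ (f ∘ suc) g x

  map++-inL : ∀ (u v u′ v′ : List A) f g i → map++ u v u′ v′ f g (inL u v i) ≡ inL u′ v′ (f i)
  map++-inL (c ∷ u) v u′ v′ f g zero    = refl
  map++-inL (c ∷ u) v u′ v′ f g (suc i) = map++-inL u v u′ v′ (f ∘ suc) g i

  map++-inR : ∀ (u v u′ v′ : List A) f g j → map++ u v u′ v′ f g (inR u v j) ≡ inR u′ v′ (g j)
  map++-inR []      v u′ v′ f g j = refl
  map++-inR (c ∷ u) v u′ v′ f g j = map++-inR u v u′ v′ (f ∘ suc) g j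

  map++-inverse : ∀ (u v u′ v′ : List A) {f : Fin (length u) → Fin (length u′)} {f′ : Fin (length u′) → Fin (length u)}
    {g : Fin (length v) → Fin (length v′)} {g′ : Fin (length v′) → Fin (length v)} →
    (∀ i → f′ (f i) ≡ i) → (∀ j → g′ (g j) ≡ j) →
    ∀ x → map++ u′ v′ u v f′ g′ (map++ u v u′ v′ f g x) ≡ x
  map++-inverse u v u′ v′ {f} {f′} {g} {g′} f′f g′g x with side++ u v x
  ... | left i  = begin
    map++ u′ v′ u v f′ g′ (map++ u v u′ v′ f g (inL u v i))
      ≡⟨ cong (map++ u′ v′ u v f′ g′) (map++-inL u v u′ v′ f g i) ⟩
    map++ u′ v′ u v f′ g′ (inL u′ v′ (f i)) ≡⟨ map++-inL u′ v′ u v f′ g′ (f i) ⟩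
    inL u v (f′ (f i))                      ≡⟨ cong (inL u v) (f′f i) ⟩
    inL u v i                               ∎
    where open ≡-Reasoning
  ... | right j = begin
    map++ u′ v′ u v f′ g′ (map++ u v u′ v′ f g (inR u v j))
      ≡⟨ cong (map++ u′ v′ u v f′ g′) (map++-inR u v u′ v′ f g j) ⟩
    map++ u′ v′ u v f′ g′ (inR u′ v′ (g j)) ≡⟨ map++-inR u′ v′ u v f′ g′ (g j) ⟩
    inR u v (g′ (g j))                      ≡⟨ cong (inR u v) (g′g j) ⟩
    inR u v j                               ∎
    where open ≡-Reasoning

  mapIx : ∀ {B : Set} (f : A → B) (w : List A) → Fin (length w) → Fin (length (map f w))
  mapIx f (c ∷ w) zero    = zero
  mapIx f (c ∷ w) (suc i) = suc (mapIx f w i)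

  unmapIx : ∀ {B : Set} (f : A → B) (w : List A) → Fin (length (map f w)) → Fin (length w)
  unmapIx f (c ∷ w) zero    = zero
  unmapIx f (c ∷ w) (suc i) = suc (unmapIx f w i)

  unmapIx-mapIx : ∀ {B : Set} (f : A → B) w i → unmapIx f w (mapIx f w i) ≡ i
  unmapIx-mapIx f (c ∷ w) zero    = refl
  unmapIx-mapIx f (c ∷ w) (suc i) = cong suc (unmapIx-mapIx f w i)

  mapIx-unmapIx : ∀ {B : Set} (f : A → B) w i → mapIx f w (unmapIx f w i) ≡ i
  mapIx-unmapIx f (c ∷ w) zero    = refl
  mapIx-unmapIx f (c ∷ w) (suc i) = cong suc (mapIx-unmapIx f w i)

  lookup-mapIx : ∀ {B : Set} (f : A → B) w i → lookup (map f w) (mapIx f w i) ≡ f (lookup w i)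
  lookup-mapIx f (c ∷ w) zero    = refl
  lookup-mapIx f (c ∷ w) (suc i) = lookup-mapIx f w i

infix 4 _≅_

record _≅_ {n n′ : ℕ} (h : LPoset n) (h′ : LPoset n′) : Set where
  field
    to      : Fin n → Fin n′
    from    : Fin n′ → Fin n
    to-from : ∀ y → to (from y) ≡ y
    from-to : ∀ x → from (to x) ≡ x
    lab-to  : ∀ x → lab h′ (to x) ≡ lab h x
    le-to   : ∀ x y → le h′ (to x) (to y) ≡ le h x y
open _≅_ public

module _ {n n′ : ℕ} {h : LPoset n} {h′ : LPoset n′} (φ : h ≅ h′) where

  to-injective : ∀ {x y} → to φ x ≡ to φ y → x ≡ y
  to-injective {x} {y} e = trans (sym (from-to φ x)) (trans (cong (from φ) e) (from-to φ y))

  lab-from : ∀ y → lab h (from φ y) ≡ lab h′ y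
  lab-from y = trans (sym (lab-to φ (from φ y))) (cong (lab h′) (to-from φ y))

  le-from : ∀ x y → le h (from φ x) (from φ y) ≡ le h′ x y
  le-from x y = trans (sym (le-to φ (from φ x) (from φ y))) (cong₂ (le h′) (to-from φ x) (to-from φ y))

  ≅-sym : h′ ≅ h
  ≅-sym = record
    { to = from φ ; from = to φ ; to-from = from-to φ ; from-to = to-from φ
    ; lab-to = lab-from ; le-to = le-from }

  maximal-≅ : ∀ x → Maximal h x → Maximal h′ (to φ x)
  maximal-≅ x x-max y x≤y = trans (sym (to-from φ y)) (cong (to φ) (x-max (from φ y) x≤from-y))
    where
      x≤from-y : le h x (from φ y) ≡ true
      x≤from-y = trans (sym (le-to φ x (from φ y))) (trans (cong (le h′ (to φ x)) (to-from φ y)) x≤y)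

≅-refl : ∀ {n} {h : LPoset n} → h ≅ h
≅-refl = record
  { to = λ x → x ; from = λ y → y ; to-from = λ _ → refl ; from-to = λ _ → refl
  ; lab-to = λ _ → refl ; le-to = λ _ _ → refl }

≅-trans : ∀ {n n′ n″} {h : LPoset n} {h′ : LPoset n′} {h″ : LPoset n″} → h ≅ h′ → h′ ≅ h″ → h ≅ h″
≅-trans φ ψ = record
  { to = to ψ ∘ to φ ; from = from φ ∘ from ψ
  ; to-from = λ y → trans (cong (to ψ) (to-from φ (from ψ y))) (to-from ψ y)
  ; from-to = λ x → trans (cong (from φ) (from-to ψ (to φ x))) (from-to φ x)
  ; lab-to = λ x → trans (lab-to ψ (to φ x)) (lab-to φ x)
  ; le-to = λ x y → trans (le-to ψ (to φ x) (to φ y)) (le-to φ x y) }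

≅-size : ∀ {n n′} {h : LPoset n} {h′ : LPoset n′} → h ≅ h′ → n ≡ n′
≅-size φ = cantor-schröder-bernstein (to-injective φ) (to-injective (≅-sym φ))

≅⇒Iso : ∀ {n} {h h′ : LPoset n} → h ≅ h′ → Iso h h′
≅⇒Iso φ = mk↔ₛ′ (to φ) (from φ) (to-from φ) (from-to φ) , lab-to φ , le-to φ

Iso⇒≅ : ∀ {n} {h h′ : LPoset n} → Iso h h′ → h ≅ h′
Iso⇒≅ (f , lab-f , le-f) = record
  { to = Inverse.to f ; from = Inverse.from f
  ; to-from = Inverse.strictlyInverseˡ f ; from-to = Inverse.strictlyInverseʳ f
  ; lab-to = lab-f ; le-to = le-f }

relabel : ∀ {n} → (ℕ → ℕ) → LPoset n → LPoset n
relabel f h = record { lab = f ∘ lab h ; le = le h }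

relabel-≅ : ∀ {n n′} {h : LPoset n} {h′ : LPoset n′} (f : ℕ → ℕ) → h ≅ h′ → relabel f h ≅ relabel f h′
relabel-≅ f φ = record
  { to = to φ ; from = from φ ; to-from = to-from φ ; from-to = from-to φ
  ; lab-to = cong f ∘ lab-to φ ; le-to = le-to φ }

relabel-≅⁻ : ∀ {n n′} {h : LPoset n} {h′ : LPoset n′} {f : ℕ → ℕ} → (∀ {a b} → f a ≡ f b → a ≡ b) →
  relabel f h ≅ relabel f h′ → h ≅ h′
relabel-≅⁻ f-inj φ = record
  { to = to φ ; from = from φ ; to-from = to-from φ ; from-to = from-to φ
  ; lab-to = f-inj ∘ lab-to φ ; le-to = le-to φ }

record Embedding {n N : ℕ} (h : LPoset n) (H : LPoset N) : Set where
  field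
    emb           : Fin n → Fin N
    emb-injective : ∀ {x y} → emb x ≡ emb y → x ≡ y
    lab-emb       : ∀ x → lab H (emb x) ≡ lab h x
    le-emb        : ∀ x y → le H (emb x) (emb y) ≡ le h x y
open Embedding public

≅-restrict : ∀ {n n′ N N′} {h : LPoset n} {h′ : LPoset n′} {H : LPoset N} {H′ : LPoset N′}
  (e : Embedding h H) (e′ : Embedding h′ H′) (φ : H ≅ H′) →
  (∀ x → ∃[ x′ ] to φ (emb e x) ≡ emb e′ x′) → (∀ x′ → ∃[ x ] from φ (emb e′ x′) ≡ emb e x) → h ≅ h′
≅-restrict {h = h} {h′} {H} {H′} e e′ φ fwd bwd = record
  { to = proj₁ ∘ fwd ; from = proj₁ ∘ bwd
  ; to-from = λ x′ → emb-injective e′ (begin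
      emb e′ (proj₁ (fwd (proj₁ (bwd x′)))) ≡⟨ sym (proj₂ (fwd _)) ⟩
      to φ (emb e (proj₁ (bwd x′)))         ≡⟨ cong (to φ) (sym (proj₂ (bwd x′))) ⟩
      to φ (from φ (emb e′ x′))             ≡⟨ to-from φ _ ⟩
      emb e′ x′                             ∎)
  ; from-to = λ x → emb-injective e (begin
      emb e (proj₁ (bwd (proj₁ (fwd x)))) ≡⟨ sym (proj₂ (bwd _)) ⟩
      from φ (emb e′ (proj₁ (fwd x)))     ≡⟨ cong (from φ) (sym (proj₂ (fwd x))) ⟩
      from φ (to φ (emb e x))             ≡⟨ from-to φ _ ⟩
      emb e x                             ∎)
  ; lab-to = λ x → begin
      lab h′ (proj₁ (fwd x))          ≡⟨ sym (lab-emb e′ _) ⟩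
      lab H′ (emb e′ (proj₁ (fwd x))) ≡⟨ cong (lab H′) (sym (proj₂ (fwd x))) ⟩
      lab H′ (to φ (emb e x))         ≡⟨ lab-to φ _ ⟩
      lab H (emb e x)                 ≡⟨ lab-emb e x ⟩
      lab h x                         ∎
  ; le-to = λ x y → begin
      le h′ (proj₁ (fwd x)) (proj₁ (fwd y))                   ≡⟨ sym (le-emb e′ _ _) ⟩
      le H′ (emb e′ (proj₁ (fwd x))) (emb e′ (proj₁ (fwd y)))
        ≡⟨ cong₂ (le H′) (sym (proj₂ (fwd x))) (sym (proj₂ (fwd y))) ⟩
      le H′ (to φ (emb e x)) (to φ (emb e y))                 ≡⟨ le-to φ _ _ ⟩
      le H (emb e x) (emb e y)                                ≡⟨ le-emb e x y ⟩
      le h x y                                                ∎ }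
  where open ≡-Reasoning

module _ {n : ℕ} (h : LPoset n) where

  downsetᵇ : ℕ → Fin n → Bool
  downsetᵇ r x = anyᶠ n (λ y → le h x y ∧ does (lab h y ≤? r))

  downset⁺ : ∀ r x y → le h x y ≡ true → lab h y ≤ r → downsetᵇ r x ≡ true
  downset⁺ r x y x≤y y≤r = anyᶠ-intro (λ y → le h x y ∧ does (lab h y ≤? r)) y (cong₂ _∧_ x≤y (dec-true (_ ≤? r) y≤r))

  downset⁻ : ∀ r x → downsetᵇ r x ≡ true → ∃[ y ] le h x y ≡ true × lab h y ≤ r
  downset⁻ r x x∈D with anyᶠ-elim (λ y → le h x y ∧ does (lab h y ≤? r)) x∈D
  ... | y , x≤y∧y≤r = y , ∧-conicalˡ (le h x y) _ x≤y∧y≤r , does⇒ (_ ≤? r) (∧-conicalʳ (le h x y) _ x≤y∧y≤r)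

downset-≅ : ∀ {n n′} {h : LPoset n} {h′ : LPoset n′} (φ : h ≅ h′) r x → downsetᵇ h′ r (to φ x) ≡ downsetᵇ h r x
downset-≅ {h = h} {h′} φ r x = Bool-ext pull push
  where
    pull : downsetᵇ h′ r (to φ x) ≡ true → downsetᵇ h r x ≡ true
    pull x∈D with downset⁻ h′ r (to φ x) x∈D
    ... | y , x≤y , y≤r = downset⁺ h r x (from φ y)
      (trans (sym (le-to φ x (from φ y))) (trans (cong (le h′ (to φ x)) (to-from φ y)) x≤y)) (subst (_≤ r) (sym (lab-from φ y)) y≤r)
    push : downsetᵇ h r x ≡ true → downsetᵇ h′ r (to φ x) ≡ true
    push x∈D with downset⁻ h r x x∈D
    ... | y , x≤y , y≤r = downset⁺ h′ r (to φ x) (to φ y) (trans (le-to φ x y) x≤y) (subst (_≤ r) (sym (lab-to φ y)) y≤r)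

_∖_ : ∀ {n} → LPoset (suc n) → Fin (suc n) → LPoset n
h ∖ a = record { lab = lab h ∘ punchIn a ; le = λ i j → le h (punchIn a i) (punchIn a j) }

∑Fin-punchIn : ∀ n (f : Fin (suc n) → ℕ) a → ∑Fin (suc n) f ≡ f a + ∑Fin n (f ∘ punchIn a)
∑Fin-punchIn n       f zero    = refl
∑Fin-punchIn (suc n) f (suc a) rewrite ∑Fin-punchIn n (f ∘ suc) a = x∙yz≈y∙xz (f zero) (f (suc a)) _

weight-∖ : ∀ {n} (h : LPoset (suc n)) a → weight h ≡ lab h a + weight (h ∖ a)
weight-∖ {n} h = ∑Fin-punchIn n (lab h)

punchIn-view : ∀ {n} (a x : Fin (suc n)) → x ≡ a ⊎ ∃[ x′ ] x ≡ punchIn a x′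
punchIn-view a x with x Fin.≟ a
... | yes x≡a = inj₁ x≡a
... | no  x≢a = inj₂ (punchOut (x≢a ∘ sym) , sym (punchIn-punchOut (x≢a ∘ sym)))

All-fromLookup : ∀ {A : Set} {P : A → Set} xs → (∀ i → P (lookup xs i)) → All P xs
All-fromLookup []       _ = []
All-fromLookup (x ∷ xs) p = p zero ∷ All-fromLookup xs (p ∘ suc)

Unique-lookup-injective : ∀ {A : Set} {xs : List A} → Unique xs → ∀ {i j} → lookup xs i ≡ lookup xs j → i ≡ j
Unique-lookup-injective (x∉xs ∷ _)  {zero}  {zero}  _ = refl
Unique-lookup-injective (x∉xs ∷ _)  {zero}  {suc j} e = contradiction e (All.lookup x∉xs (∈-lookup j))
Unique-lookup-injective (x∉xs ∷ _)  {suc i} {zero}  e = contradiction (sym e) (All.lookup x∉xs (∈-lookup i))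
Unique-lookup-injective (_ ∷ uniq) {suc i} {suc j} e = cong suc (Unique-lookup-injective uniq e)

concatUpTo : {A : Set} → ℕ → (ℕ → List A) → List A
concatUpTo zero    f = f 0
concatUpTo (suc n) f = concatUpTo n f ++ f (suc n)

stackings : {A : Set} → List (List A) → List (List A) → List (List A)
stackings []            tops = []
stackings (v ∷ bottoms) tops = map (_++ v) tops ++ stackings bottoms tops

-- Graded like FPS: P n m holds words with n pieces and abscissa sum m.
Family : Set
Family = ℕ → ℕ → List (List ℕ)

counts : Family → FPS
counts P n m = length (P n m)

shift : ℕ → List ℕ → List ℕ
shift r = map (r +_)

scaleW : ℕ → Family → Family
scaleW j P n m with j * n ≤? m
... | yes _ = map (shift j) (P n (m ∸ j * n))
... | no  _ = []

mulW : Family → Family → Family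
mulW P Q n m = concatUpTo n λ a → concatUpTo m λ b → stackings (P a b) (Q (n ∸ a) (m ∸ b))

prodW : ℕ → (ℕ → Family) → Family
prodW zero    F = F 0
prodW (suc j) F = mulW (prodW j F) (F (suc j))

length-concatUpTo : ∀ {A : Set} n (f : ℕ → List A) → length (concatUpTo n f) ≡ sumTo n (length ∘ f)
length-concatUpTo zero    f = refl
length-concatUpTo (suc n) f = trans (length-++ (concatUpTo n f)) (cong (_+ length (f (suc n))) (length-concatUpTo n f))

length-stackings : ∀ {A : Set} (bottoms tops : List (List A)) → length (stackings bottoms tops) ≡ length bottoms * length tops
length-stackings []            tops = refl
length-stackings (v ∷ bottoms) tops =
  trans (length-++ (map (_++ v) tops)) (cong₂ _+_ (length-map (_++ v) tops) (length-stackings bottoms tops))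

counts-scaleW : ∀ j P n m → counts (scaleW j P) n m ≡ scaleS j (counts P) n m
counts-scaleW j P n m with j * n ≤? m
... | yes _ = length-map (shift j) (P n (m ∸ j * n))
... | no  _ = refl

sumTo-cong : ∀ n {f g : ℕ → ℕ} → (∀ a → a ≤ n → f a ≡ g a) → sumTo n f ≡ sumTo n g
sumTo-cong zero    f≡g = f≡g 0 z≤n
sumTo-cong (suc n) f≡g = cong₂ _+_ (sumTo-cong n (λ a a≤n → f≡g a (m≤n⇒m≤1+n a≤n))) (f≡g (suc n) ≤-refl)

counts-mulW : ∀ P Q n m → counts (mulW P Q) n m ≡ (counts P ⊗ counts Q) n m
counts-mulW P Q n m =
  trans (length-concatUpTo n _) (sumTo-cong n λ a _ →
    trans (length-concatUpTo m _) (sumTo-cong m λ b _ → length-stackings (P a b) (Q (n ∸ a) (m ∸ b))))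

counts-prodW : ∀ j F n m → counts (prodW j F) n m ≡ prodS j (counts ∘ F) n m
counts-prodW zero    F n m = refl
counts-prodW (suc j) F n m =
  trans (counts-mulW (prodW j F) (F (suc j)) n m)
        (sumTo-cong n λ a _ → sumTo-cong m λ b _ → cong (_* counts (F (suc j)) (n ∸ a) (m ∸ b)) (counts-prodW j F a b))

scaleS-cong-≤ : ∀ j {f g : FPS} n m → (∀ b → f n b ≡ g n b) → scaleS j f n m ≡ scaleS j g n m
scaleS-cong-≤ j n m f≡g with j * n ≤? m
... | yes _ = f≡g (m ∸ j * n)
... | no  _ = refl

prodS-cong-≤ : ∀ j {F G : ℕ → FPS} n m → (∀ i a b → a ≤ n → F i a b ≡ G i a b) → prodS j F n m ≡ prodS j G n m
prodS-cong-≤ zero    n m F≡G = F≡G 0 n m ≤-refl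
prodS-cong-≤ (suc j) n m F≡G = sumTo-cong n λ a a≤n → sumTo-cong m λ b _ →
  cong₂ _*_ (prodS-cong-≤ j a b (λ i a′ b′ a′≤a → F≡G i a′ b′ (≤-trans a′≤a a≤n)))
            (F≡G (suc j) (n ∸ a) (m ∸ b) (m∸n≤m n a))

∈-concatUpTo⁻ : ∀ {A : Set} n (f : ℕ → List A) {x} → x ∈ concatUpTo n f → ∃[ a ] a ≤ n × x ∈ f a
∈-concatUpTo⁻ zero    f x∈ = 0 , z≤n , x∈
∈-concatUpTo⁻ (suc n) f x∈ with ∈-++⁻ (concatUpTo n f) x∈
... | inj₂ x∈last = suc n , ≤-refl , x∈last
... | inj₁ x∈init with ∈-concatUpTo⁻ n f x∈init
...   | a , a≤n , x∈fa = a , m≤n⇒m≤1+n a≤n , x∈fa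

∈-concatUpTo⁺ : ∀ {A : Set} n (f : ℕ → List A) {x a} → a ≤ n → x ∈ f a → x ∈ concatUpTo n f
∈-concatUpTo⁺ zero    f z≤n x∈ = x∈
∈-concatUpTo⁺ (suc n) f {a = a} a≤1+n x∈ with m≤n⇒m<n∨m≡n a≤1+n
... | inj₁ (s≤s a≤n) = ∈-++⁺ˡ (∈-concatUpTo⁺ n f a≤n x∈)
... | inj₂ refl      = ∈-++⁺ʳ (concatUpTo n f) x∈

∈-stackings⁻ : ∀ {A : Set} (bottoms tops : List (List A)) {x} → x ∈ stackings bottoms tops →
  ∃[ v ] ∃[ u ] v ∈ bottoms × u ∈ tops × x ≡ u ++ v
∈-stackings⁻ (v ∷ bottoms) tops x∈ with ∈-++⁻ (map (_++ v) tops) x∈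
... | inj₁ x∈first with ∈-map⁻ (_++ v) x∈first
...   | u , u∈ , x≡ = v , u , here refl , u∈ , x≡
∈-stackings⁻ (v ∷ bottoms) tops x∈ | inj₂ x∈rest with ∈-stackings⁻ bottoms tops x∈rest
...   | v′ , u , v′∈ , u∈ , x≡ = v′ , u , there v′∈ , u∈ , x≡

∈-stackings⁺ : ∀ {A : Set} (bottoms tops : List (List A)) {v u} → v ∈ bottoms → u ∈ tops → u ++ v ∈ stackings bottoms tops
∈-stackings⁺ (v ∷ bottoms) tops (here refl) u∈ = ∈-++⁺ˡ (∈-map⁺ (_++ v) u∈)
∈-stackings⁺ (v ∷ bottoms) tops (there v∈)  u∈ = ∈-++⁺ʳ (map (_++ v) tops) (∈-stackings⁺ bottoms tops v∈ u∈)

∈-scaleW⁻ : ∀ j P n m {x} → x ∈ scaleW j P n m → j * n ≤ m × ∃[ y ] y ∈ P n (m ∸ j * n) × x ≡ shift j y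
∈-scaleW⁻ j P n m x∈ with j * n ≤? m
... | yes jn≤m with ∈-map⁻ (shift j) x∈
...   | y , y∈ , x≡ = jn≤m , y , y∈ , x≡

∈-scaleW⁺ : ∀ j P n m {y} → j * n ≤ m → y ∈ P n (m ∸ j * n) → shift j y ∈ scaleW j P n m
∈-scaleW⁺ j P n m jn≤m y∈ with j * n ≤? m
... | yes _    = ∈-map⁺ (shift j) y∈
... | no  jn≰m = contradiction jn≤m jn≰m

record MulW-∈ (P Q : Family) (n m : ℕ) (x : List ℕ) : Set where
  field
    {a b}      : ℕ
    a≤n        : a ≤ n
    b≤m        : b ≤ m
    bottom top : List ℕ
    bottom∈    : bottom ∈ P a b
    top∈       : top ∈ Q (n ∸ a) (m ∸ b)
    x≡         : x ≡ top ++ bottom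

∈-mulW⁻ : ∀ P Q n m {x} → x ∈ mulW P Q n m → MulW-∈ P Q n m x
∈-mulW⁻ P Q n m x∈ with ∈-concatUpTo⁻ n _ x∈
... | a , a≤n , x∈a with ∈-concatUpTo⁻ m _ x∈a
...   | b , b≤m , x∈ab with ∈-stackings⁻ (P a b) _ x∈ab
...     | v , u , v∈ , u∈ , x≡ = record { a≤n = a≤n ; b≤m = b≤m ; bottom∈ = v∈ ; top∈ = u∈ ; x≡ = x≡ }

∈-mulW⁺ : ∀ P Q n m {a b u v} → a ≤ n → b ≤ m → v ∈ P a b → u ∈ Q (n ∸ a) (m ∸ b) → u ++ v ∈ mulW P Q n m
∈-mulW⁺ P Q n m a≤n b≤m v∈ u∈ =
  ∈-concatUpTo⁺ n _ a≤n (∈-concatUpTo⁺ m _ b≤m (∈-stackings⁺ (P _ _) _ v∈ u∈))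

++-injective : ∀ {A : Set} (u u′ : List A) {v v′} → length u ≡ length u′ → u ++ v ≡ u′ ++ v′ → u ≡ u′ × v ≡ v′
++-injective []      []       _  e = refl , e
++-injective (c ∷ u) (c′ ∷ u′) ∣u∣≡ e with ∷-injective e
... | refl , e′ with ++-injective u u′ (ℕ.suc-injective ∣u∣≡) e′
...   | refl , refl = refl , refl

Unique-concatUpTo : ∀ {A : Set} n (f : ℕ → List A) → (∀ a → a ≤ n → Unique (f a)) →
  (∀ {a a′ x} → a ≤ n → a′ ≤ n → x ∈ f a → x ∈ f a′ → a ≡ a′) → Unique (concatUpTo n f)
Unique-concatUpTo zero    f unique _        = unique 0 z≤n
Unique-concatUpTo (suc n) f unique disjoint =
  Unique.++⁺ (Unique-concatUpTo n f (λ a a≤n → unique a (m≤n⇒m≤1+n a≤n))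
                (λ a≤n a′≤n → disjoint (m≤n⇒m≤1+n a≤n) (m≤n⇒m≤1+n a′≤n)))
             (unique (suc n) ≤-refl) apart
  where
    apart : ∀ {x} → x ∈ concatUpTo n f × x ∈ f (suc n) → ⊥
    apart (x∈init , x∈last) with ∈-concatUpTo⁻ n f x∈init
    ... | a , a≤n , x∈fa with disjoint (m≤n⇒m≤1+n a≤n) ≤-refl x∈fa x∈last
    ...   | refl = <-irrefl refl a≤n

Unique-stackings : ∀ {A : Set} ℓ (bottoms tops : List (List A)) → Unique bottoms → Unique tops →
  (∀ {u} → u ∈ tops → length u ≡ ℓ) → Unique (stackings bottoms tops)
Unique-stackings ℓ []            tops _                 _           _       = []
Unique-stackings ℓ (v ∷ bottoms) tops (v∉bottoms ∷ uniq) unique-tops ∣tops∣ =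
  Unique.++⁺ (Unique.map⁺ (++-cancelʳ v _ _) unique-tops) (Unique-stackings ℓ bottoms tops uniq unique-tops ∣tops∣) apart
  where
    apart : ∀ {x} → x ∈ map (_++ v) tops × x ∈ stackings bottoms tops → ⊥
    apart (x∈first , x∈rest) with ∈-map⁻ (_++ v) x∈first | ∈-stackings⁻ bottoms tops x∈rest
    ... | u , u∈ , refl | v′ , u′ , v′∈ , u′∈ , e with ++-injective u u′ (trans (∣tops∣ u∈) (sym (∣tops∣ u′∈))) e
    ...   | refl , refl = All.lookup v∉bottoms v′∈ refl

Unique-scaleW : ∀ j P n m → Unique (P n (m ∸ j * n)) → Unique (scaleW j P n m)
Unique-scaleW j P n m unique with j * n ≤? m
... | yes _ = Unique.map⁺ (map-injective (+-cancelˡ-≡ j _ _)) unique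
... | no  _ = []

Unique-mulW : ∀ P Q n m → (∀ a b → Unique (P a b)) → (∀ a b → Unique (Q a b)) →
  (∀ a b {u} → u ∈ Q a b → length u ≡ a) →
  (∀ {a b a′ b′ u v u′ v′} → v ∈ P a b → u ∈ Q (n ∸ a) (m ∸ b) →
     v′ ∈ P a′ b′ → u′ ∈ Q (n ∸ a′) (m ∸ b′) → u ++ v ≡ u′ ++ v′ → a ≡ a′ × b ≡ b′) →
  Unique (mulW P Q n m)
Unique-mulW P Q n m uP uQ ∣Q∣ split-unique =
  Unique-concatUpTo n _ (λ a _ → Unique-concatUpTo m _
    (λ b _ → Unique-stackings (n ∸ a) (P a b) _ (uP a b) (uQ _ _) (∣Q∣ _ _))
    (λ _ _ x∈ x∈′ → proj₂ (same-split x∈ x∈′)))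
    (λ _ _ x∈ x∈′ → proj₁ (same-split (proj₂ (proj₂ (∈-concatUpTo⁻ m _ x∈)))
                                       (proj₂ (proj₂ (∈-concatUpTo⁻ m _ x∈′)))))
  where
    same-split : ∀ {a b a′ b′ x} → x ∈ stackings (P a b) (Q (n ∸ a) (m ∸ b)) →
      x ∈ stackings (P a′ b′) (Q (n ∸ a′) (m ∸ b′)) → a ≡ a′ × b ≡ b′
    same-split x∈ x∈′ with ∈-stackings⁻ (P _ _) _ x∈ | ∈-stackings⁻ (P _ _) _ x∈′
    ... | v , u , v∈ , u∈ , refl | v′ , u′ , v′∈ , u′∈ , e = split-unique v∈ u∈ v′∈ u′∈ e

module _ (k : ℕ) where

  conc? : ∀ a b → Dec (Conc k a b)
  conc? a b = (a ≤? b + k) ×-dec (b ≤? a + k)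

  concᵇ : ℕ → ℕ → Bool
  concᵇ a b = does (conc? a b)

  -- A word c ∷ w lists the pieces from the top down: c is dropped last onto the heap of w,
  -- and so lies above exactly the pieces lying below some piece of w concurrent with c.
  below : (w : List ℕ) → Fin (length w) → Fin (length w) → Bool
  below (c ∷ w) zero    zero    = true
  below (c ∷ w) zero    (suc j) = false
  below (c ∷ w) (suc i) zero    = anyᶠ _ (λ l → below w i l ∧ concᵇ (lookup w l) c)
  below (c ∷ w) (suc i) (suc j) = below w i j

  heapOf : (w : List ℕ) → LPoset (length w)
  heapOf w = record { lab = lookup w ; le = below w }

  below-top⁺ : ∀ c w i l → below w i l ≡ true → Conc k (lookup w l) c → below (c ∷ w) (suc i) zero ≡ true
  below-top⁺ c w i l i≤l l~c =
    anyᶠ-intro (λ l → below w i l ∧ concᵇ (lookup w l) c) l (cong₂ _∧_ i≤l (dec-true (conc? _ _) l~c))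

  below-top⁻ : ∀ c w i → below (c ∷ w) (suc i) zero ≡ true → ∃[ l ] below w i l ≡ true × Conc k (lookup w l) c
  below-top⁻ c w i i≤c with anyᶠ-elim (λ l → below w i l ∧ concᵇ (lookup w l) c) i≤c
  ... | l , i≤l∧l~c = l , ∧-conicalˡ (below w i l) _ i≤l∧l~c , does⇒ (conc? _ _) (∧-conicalʳ (below w i l) _ i≤l∧l~c)

  below-refl : ∀ w i → below w i i ≡ true
  below-refl (c ∷ w) zero    = refl
  below-refl (c ∷ w) (suc i) = below-refl w i

  below-trans : ∀ w i j l → below w i j ≡ true → below w j l ≡ true → below w i l ≡ true
  below-trans (c ∷ w) zero    zero    l       _   j≤l = j≤l
  below-trans (c ∷ w) (suc i) zero    zero    i≤j _   = i≤j
  below-trans (c ∷ w) (suc i) (suc j) (suc l) i≤j j≤l = below-trans w i j l i≤j j≤l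
  below-trans (c ∷ w) (suc i) (suc j) zero    i≤j j≤0 with below-top⁻ c w j j≤0
  ... | m , j≤m , m~c = below-top⁺ c w i m (below-trans w i j m i≤j j≤m) m~c

  below-antisym : ∀ w i j → below w i j ≡ true → below w j i ≡ true → i ≡ j
  below-antisym (c ∷ w) zero    zero    _   _   = refl
  below-antisym (c ∷ w) (suc i) (suc j) i≤j j≤i = cong suc (below-antisym w i j i≤j j≤i)

  below-A1 : ∀ w i j → Conc k (lookup w i) (lookup w j) → below w i j ≡ true ⊎ below w j i ≡ true
  below-A1 (c ∷ w) zero    zero    _   = inj₁ refl
  below-A1 (c ∷ w) zero    (suc j) c~j = inj₂ (below-top⁺ c w j j (below-refl w j) (swap c~j))
  below-A1 (c ∷ w) (suc i) zero    i~c = inj₁ (below-top⁺ c w i i (below-refl w i) i~c)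
  below-A1 (c ∷ w) (suc i) (suc j) i~j = below-A1 w i j i~j

  below-A2 : ∀ w i j → Covers (heapOf w) i j → Conc k (lookup w i) (lookup w j)
  below-A2 (c ∷ w) zero    zero    (_ , i≢i , _) = contradiction refl i≢i
  below-A2 (c ∷ w) (suc i) zero    (i≤0 , _ , between) with below-top⁻ c w i i≤0
  ... | l , i≤l , l~c with between (suc l) i≤l (below-top⁺ c w l l (below-refl w l) l~c)
  ...   | inj₁ refl = l~c
  below-A2 (c ∷ w) (suc i) (suc j) (i≤j , i≢j , between) =
    below-A2 w i j (i≤j , i≢j ∘ cong suc , λ g i≤g g≤j → Sum.map suc-injective suc-injective (between (suc g) i≤g g≤j))

  heapOf-isHeap : ∀ w → All (1 ≤_) w → IsHeap k (heapOf w)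
  heapOf-isHeap w w≥1 = record
    { lab≥1 = λ i → All.lookup w≥1 (∈-lookup i)
    ; refl≤ = below-refl w ; antisym = below-antisym w ; trans≤ = below-trans w
    ; A1 = below-A1 w ; A2 = below-A2 w }

  ≅-empty : (h : LPoset 0) → h ≅ heapOf []
  ≅-empty h = record { to = λ () ; from = λ () ; to-from = λ () ; from-to = λ () ; lab-to = λ () ; le-to = λ () }

  below-LR : ∀ u v i j → below (u ++ v) (inL u v i) (inR u v j) ≡ false
  below-LR (c ∷ u) v zero    j = refl
  below-LR (c ∷ u) v (suc i) j = below-LR u v i j

  below-RR : ∀ u v j j′ → below (u ++ v) (inR u v j) (inR u v j′) ≡ below v j j′
  below-RR []      v j j′ = refl
  below-RR (c ∷ u) v j j′ = below-RR u v j j′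

  below-LL : ∀ u v i i′ → below (u ++ v) (inL u v i) (inL u v i′) ≡ below u i i′
  below-LL (c ∷ u) v zero    zero     = refl
  below-LL (c ∷ u) v zero    (suc i′) = refl
  below-LL (c ∷ u) v (suc i) (suc i′) = below-LL u v i i′
  below-LL (c ∷ u) v (suc i) zero     = Bool-ext restrict extend
    where
      restrict : below (c ∷ u ++ v) (suc (inL u v i)) zero ≡ true → below (c ∷ u) (suc i) zero ≡ true
      restrict i≤c with below-top⁻ c (u ++ v) (inL u v i) i≤c
      ... | l , i≤l , l~c with side++ u v l
      ...   | left i′  = below-top⁺ c u i i′ (trans (sym (below-LL u v i i′)) i≤l)
                                             (subst (λ a → Conc k a c) (lookup-inL u v i′) l~c)
      ...   | right j′ = contradiction (trans (sym (below-LR u v i j′)) i≤l) false≢true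
      extend : below (c ∷ u) (suc i) zero ≡ true → below (c ∷ u ++ v) (suc (inL u v i)) zero ≡ true
      extend i≤c with below-top⁻ c u i i≤c
      ... | l , i≤l , l~c =
        below-top⁺ c (u ++ v) (inL u v i) (inL u v l) (trans (below-LL u v i l) i≤l)
                   (subst (λ a → Conc k a c) (sym (lookup-inL u v l)) l~c)

  Bridge : ∀ u v → Fin (length v) → Fin (length u) → Set
  Bridge u v j i = ∃[ j′ ] ∃[ i′ ] below v j j′ ≡ true × Conc k (lookup v j′) (lookup u i′) × below u i′ i ≡ true

  below-RL⇒Bridge : ∀ u v j i → below (u ++ v) (inR u v j) (inL u v i) ≡ true → Bridge u v j i
  below-RL⇒Bridge (c ∷ u) v j (suc i) j≤i with below-RL⇒Bridge u v j i j≤i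
  ... | j′ , i′ , j≤j′ , j′~i′ , i′≤i = j′ , suc i′ , j≤j′ , j′~i′ , i′≤i
  below-RL⇒Bridge (c ∷ u) v j zero j≤c with below-top⁻ c (u ++ v) (inR u v j) j≤c
  ... | l , j≤l , l~c with side++ u v l
  ...   | right j′ = j′ , zero , trans (sym (below-RR u v j j′)) j≤l , subst (λ a → Conc k a c) (lookup-inR u v j′) l~c , refl
  ...   | left i′ with below-RL⇒Bridge u v j i′ j≤l
  ...     | j′ , i″ , j≤j′ , j′~i″ , i″≤i′ =
    j′ , suc i″ , j≤j′ , j′~i″ , below-top⁺ c u i″ i′ i″≤i′ (subst (λ a → Conc k a c) (lookup-inL u v i′) l~c)

  Bridge⇒below-RL : ∀ u v j i → Bridge u v j i → below (u ++ v) (inR u v j) (inL u v i) ≡ true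
  Bridge⇒below-RL (c ∷ u) v j (suc i) (j′ , suc i′ , j≤j′ , j′~i′ , i′≤i) =
    Bridge⇒below-RL u v j i (j′ , i′ , j≤j′ , j′~i′ , i′≤i)
  Bridge⇒below-RL (c ∷ u) v j zero    (j′ , zero , j≤j′ , j′~c , _) =
    below-top⁺ c (u ++ v) (inR u v j) (inR u v j′) (trans (below-RR u v j j′) j≤j′)
               (subst (λ a → Conc k a c) (sym (lookup-inR u v j′)) j′~c)
  Bridge⇒below-RL (c ∷ u) v j zero    (j′ , suc i′ , j≤j′ , j′~i′ , i′≤c) with below-top⁻ c u i′ i′≤c
  ... | l , i′≤l , l~c = below-top⁺ c (u ++ v) (inR u v j) (inL u v l)
                           (Bridge⇒below-RL u v j l (j′ , i′ , j≤j′ , j′~i′ , i′≤l))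
                           (subst (λ a → Conc k a c) (sym (lookup-inL u v l)) l~c)

  Bridge-≅ : ∀ u u′ v v′ (φ : heapOf u ≅ heapOf u′) (ψ : heapOf v ≅ heapOf v′) {j i} →
    Bridge u v j i → Bridge u′ v′ (to ψ j) (to φ i)
  Bridge-≅ u u′ v v′ φ ψ (j′ , i′ , j≤j′ , j′~i′ , i′≤i) =
    to ψ j′ , to φ i′ , trans (le-to ψ _ j′) j≤j′ ,
    subst₂ (Conc k) (sym (lab-to ψ j′)) (sym (lab-to φ i′)) j′~i′ , trans (le-to φ i′ _) i′≤i

  ≅-++ : ∀ u u′ v v′ → heapOf u ≅ heapOf u′ → heapOf v ≅ heapOf v′ → heapOf (u ++ v) ≅ heapOf (u′ ++ v′)
  ≅-++ u u′ v v′ φ ψ = record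
    { to      = map++ u v u′ v′ (to φ) (to ψ)
    ; from    = map++ u′ v′ u v (from φ) (from ψ)
    ; to-from = map++-inverse u′ v′ u v (to-from φ) (to-from ψ)
    ; from-to = map++-inverse u v u′ v′ (from-to φ) (from-to ψ)
    ; lab-to  = lab-map++
    ; le-to   = le-map++ }
    where
      lab-map++ : ∀ x → lookup (u′ ++ v′) (map++ u v u′ v′ (to φ) (to ψ) x) ≡ lookup (u ++ v) x
      lab-map++ x with side++ u v x
      ... | left i  rewrite map++-inL u v u′ v′ (to φ) (to ψ) i | lookup-inL u′ v′ (to φ i) | lookup-inL u v i = lab-to φ i
      ... | right j rewrite map++-inR u v u′ v′ (to φ) (to ψ) j | lookup-inR u′ v′ (to ψ j) | lookup-inR u v j = lab-to ψ j
      le-map++ : ∀ x y → below (u′ ++ v′) (map++ u v u′ v′ (to φ) (to ψ) x) (map++ u v u′ v′ (to φ) (to ψ) y)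
                         ≡ below (u ++ v) x y
      le-map++ x y with side++ u v x | side++ u v y
      ... | left i | left i′
        rewrite map++-inL u v u′ v′ (to φ) (to ψ) i | map++-inL u v u′ v′ (to φ) (to ψ) i′
              | below-LL u′ v′ (to φ i) (to φ i′) | below-LL u v i i′ = le-to φ i i′
      ... | left i | right j
        rewrite map++-inL u v u′ v′ (to φ) (to ψ) i | map++-inR u v u′ v′ (to φ) (to ψ) j
              | below-LR u′ v′ (to φ i) (to ψ j) | below-LR u v i j = refl
      ... | right j | right j′
        rewrite map++-inR u v u′ v′ (to φ) (to ψ) j | map++-inR u v u′ v′ (to φ) (to ψ) j′
              | below-RR u′ v′ (to ψ j) (to ψ j′) | below-RR u v j j′ = le-to ψ j j′
      ... | right j | left i
        rewrite map++-inR u v u′ v′ (to φ) (to ψ) j | map++-inL u v u′ v′ (to φ) (to ψ) i = Bool-ext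
          (λ j≤i → Bridge⇒below-RL u v j i
            (subst₂ (Bridge u v) (from-to ψ j) (from-to φ i)
              (Bridge-≅ u′ u v′ v (≅-sym φ) (≅-sym ψ) (below-RL⇒Bridge u′ v′ _ _ j≤i))))
          (λ j≤i → Bridge⇒below-RL u′ v′ _ _ (Bridge-≅ u u′ v v′ φ ψ (below-RL⇒Bridge u v j i j≤i)))

  ≅-∷ : ∀ c w w′ → heapOf w ≅ heapOf w′ → heapOf (c ∷ w) ≅ heapOf (c ∷ w′)
  ≅-∷ c w w′ = ≅-++ (c ∷ []) (c ∷ []) w w′ ≅-refl

  inL-embedding : ∀ u v → Embedding (heapOf u) (heapOf (u ++ v))
  inL-embedding u v = record
    { emb = inL u v ; emb-injective = inL-injective u v ; lab-emb = lookup-inL u v ; le-emb = below-LL u v }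

  inR-embedding : ∀ u v → Embedding (heapOf v) (heapOf (u ++ v))
  inR-embedding u v = record
    { emb = inR u v ; emb-injective = inR-injective u v ; lab-emb = lookup-inR u v ; le-emb = below-RR u v }

  left-preserved : ∀ {u v u′ v′ : List ℕ} {h : LPoset (length (u ++ v))} {h′ : LPoset (length (u′ ++ v′))} (φ : h ≅ h′) →
    (∀ j′ → ∃[ j ] from φ (inR u′ v′ j′) ≡ inR u v j) → ∀ i → ∃[ i′ ] to φ (inL u v i) ≡ inL u′ v′ i′
  left-preserved {u} {v} {u′} {v′} φ bwd i with inL-or-inR u′ v′ (to φ (inL u v i))
  ... | inj₁ (i′ , e) = i′ , e
  ... | inj₂ (j′ , e) with bwd j′
  ...   | j , from-j′≡j = contradiction (trans (sym (from-to φ _)) (trans (cong (from φ) e) from-j′≡j)) (inL≢inR u v i j)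

  ≅-split : ∀ u u′ v v′ (φ : heapOf (u ++ v) ≅ heapOf (u′ ++ v′)) →
    (∀ j → ∃[ j′ ] to φ (inR u v j) ≡ inR u′ v′ j′) → (∀ j′ → ∃[ j ] from φ (inR u′ v′ j′) ≡ inR u v j) →
    heapOf u ≅ heapOf u′ × heapOf v ≅ heapOf v′
  ≅-split u u′ v v′ φ fwd bwd =
    ≅-restrict (inL-embedding u v) (inL-embedding u′ v′) φ left→left left←left ,
    ≅-restrict (inR-embedding u v) (inR-embedding u′ v′) φ fwd bwd
    where
      left→left : ∀ i → ∃[ i′ ] to φ (inL u v i) ≡ inL u′ v′ i′
      left→left = left-preserved φ bwd
      left←left : ∀ i′ → ∃[ i ] from φ (inL u′ v′ i′) ≡ inL u v i
      left←left = left-preserved (≅-sym φ) fwd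

  module _ (f : ℕ → ℕ) (f-conc⁺ : ∀ {a b} → Conc k a b → Conc k (f a) (f b))
           (f-conc⁻ : ∀ {a b} → Conc k (f a) (f b) → Conc k a b) where

    below-mapIx : ∀ w i j → below (map f w) (mapIx f w i) (mapIx f w j) ≡ below w i j
    below-mapIx (c ∷ w) zero    zero    = refl
    below-mapIx (c ∷ w) zero    (suc j) = refl
    below-mapIx (c ∷ w) (suc i) (suc j) = below-mapIx w i j
    below-mapIx (c ∷ w) (suc i) zero    = Bool-ext unmap-below remap-below
      where
        unmap-below : below (f c ∷ map f w) (suc (mapIx f w i)) zero ≡ true → below (c ∷ w) (suc i) zero ≡ true
        unmap-below i≤c with below-top⁻ (f c) (map f w) (mapIx f w i) i≤c
        ... | l , i≤l , l~c rewrite sym (mapIx-unmapIx f w l) =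
          below-top⁺ c w i (unmapIx f w l) (trans (sym (below-mapIx w i _)) i≤l)
            (f-conc⁻ (subst (λ a → Conc k a (f c)) (lookup-mapIx f w _) l~c))
        remap-below : below (c ∷ w) (suc i) zero ≡ true → below (f c ∷ map f w) (suc (mapIx f w i)) zero ≡ true
        remap-below i≤c with below-top⁻ c w i i≤c
        ... | l , i≤l , l~c = below-top⁺ (f c) (map f w) (mapIx f w i) (mapIx f w l) (trans (below-mapIx w i l) i≤l)
                                (subst (λ a → Conc k a (f c)) (sym (lookup-mapIx f w l)) (f-conc⁺ l~c))

    heapOf-map : ∀ w → heapOf (map f w) ≅ relabel f (heapOf w)
    heapOf-map w = record
      { to = unmapIx f w ; from = mapIx f w ; to-from = unmapIx-mapIx f w ; from-to = mapIx-unmapIx f w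
      ; lab-to = λ x → trans (sym (lookup-mapIx f w _)) (cong (lookup (map f w)) (mapIx-unmapIx f w x))
      ; le-to = λ x y → trans (sym (below-mapIx w _ _)) (cong₂ (below (map f w)) (mapIx-unmapIx f w x) (mapIx-unmapIx f w y)) }

    ≅-map : ∀ u u′ → heapOf u ≅ heapOf u′ → heapOf (map f u) ≅ heapOf (map f u′)
    ≅-map u u′ φ = ≅-trans (heapOf-map u) (≅-trans (relabel-≅ f φ) (≅-sym (heapOf-map u′)))

    ≅-unmap : (∀ {a b} → f a ≡ f b → a ≡ b) → ∀ u u′ → heapOf (map f u) ≅ heapOf (map f u′) → heapOf u ≅ heapOf u′
    ≅-unmap f-inj u u′ φ = relabel-≅⁻ f-inj (≅-trans (≅-sym (heapOf-map u)) (≅-trans φ (heapOf-map u′)))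

  conc-shift⁺ : ∀ r {a b} → Conc k a b → Conc k (r + a) (r + b)
  conc-shift⁺ r (a≤b+k , b≤a+k) = shift-≤ a≤b+k , shift-≤ b≤a+k
    where
      shift-≤ : ∀ {a b} → a ≤ b + k → r + a ≤ r + b + k
      shift-≤ {a} {b} a≤b+k = subst (r + a ≤_) (sym (+-assoc r b k)) (+-monoʳ-≤ r a≤b+k)

  conc-shift⁻ : ∀ r {a b} → Conc k (r + a) (r + b) → Conc k a b
  conc-shift⁻ r (a≤b+k , b≤a+k) = unshift-≤ a≤b+k , unshift-≤ b≤a+k
    where
      unshift-≤ : ∀ {a b} → r + a ≤ r + b + k → a ≤ b + k
      unshift-≤ {a} {b} le = +-cancelˡ-≤ r a (b + k) (subst (r + a ≤_) (+-assoc r b k) le)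

  ≅-shift : ∀ r u u′ → heapOf u ≅ heapOf u′ → heapOf (shift r u) ≅ heapOf (shift r u′)
  ≅-shift r = ≅-map (r +_) (conc-shift⁺ r) (conc-shift⁻ r)

  ≅-unshift : ∀ r u u′ → heapOf (shift r u) ≅ heapOf (shift r u′) → heapOf u ≅ heapOf u′
  ≅-unshift r = ≅-unmap (r +_) (conc-shift⁺ r) (conc-shift⁻ r) (+-cancelˡ-≡ r _ _)

  module _ {n} {h : LPoset n} (h-heap : IsHeap k h) where
    open IsHeap h-heap

    maximal-above : ∀ x → ∃[ a ] le h x a ≡ true × Maximal h a
    maximal-above x with maximalIn-exists (le h) antisym trans≤ (λ g → le h x g Bool.≟ true) x (refl≤ x)
    ... | a , x≤a , a-max = a , x≤a , λ b a≤b → a-max b (trans≤ x a b x≤a a≤b) a≤b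

    below-unique-maximal : ∀ a → (∀ b → Maximal h b → b ≡ a) → ∀ x → le h x a ≡ true
    below-unique-maximal a unique x with maximal-above x
    ... | b , x≤b , b-max = subst (λ b → le h x b ≡ true) (unique b b-max) x≤b

    maximal-≡ : ∀ {a b} → Maximal h a → Maximal h b → lab h a ≡ lab h b → a ≡ b
    maximal-≡ {a} {b} a-max b-max a≡b with A1 a b (subst (Conc k (lab h a)) a≡b (m≤m+n _ k , m≤m+n _ k))
    ... | inj₁ a≤b = sym (a-max b a≤b)
    ... | inj₂ b≤a = b-max a b≤a

    covered-below : ∀ x a → le h x a ≡ true → x ≢ a → ∃[ g ] le h x g ≡ true × Covers h g a
    covered-below x a x≤a x≢a with maximalIn-exists (le h) antisym trans≤
        (λ g → (le h x g Bool.≟ true) ×-dec (le h g a Bool.≟ true) ×-dec ¬? (g Fin.≟ a)) x (refl≤ x , x≤a , x≢a)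
    ... | g , (x≤g , g≤a , g≢a) , g-max = g , x≤g , g≤a , g≢a , between
      where
        between : ∀ g′ → le h g g′ ≡ true → le h g′ a ≡ true → g′ ≡ g ⊎ g′ ≡ a
        between g′ g≤g′ g′≤a with g′ Fin.≟ a
        ... | yes g′≡a = inj₂ g′≡a
        ... | no  g′≢a = inj₁ (g-max g′ (trans≤ x g g′ x≤g g≤g′ , g′≤a , g′≢a) g≤g′)

  counted-if-maxima-at-1 : ∀ {n} {h : LPoset n} → IsHeap k h → (∀ x → Maximal h x → lab h x ≤ 1) → Counted h
  counted-if-maxima-at-1 {zero}  _      _  = inj₁ refl
  counted-if-maxima-at-1 {suc n} {h} h-heap max≤1 with maximal-above h-heap zero
  ... | a , _ , a-max =
    inj₂ (a , a-max , at-1 a a-max , λ b b-max → maximal-≡ h-heap b-max a-max (trans (at-1 b b-max) (sym (at-1 a a-max))))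
    where
      at-1 : ∀ x → Maximal h x → lab h x ≡ 1
      at-1 x x-max = ≤-antisym (max≤1 x x-max) (IsHeap.lab≥1 h-heap x)

  module _ {n} {h : LPoset (suc n)} (h-heap : IsHeap k h) (a : Fin (suc n)) (a-max : Maximal h a) where
    open IsHeap h-heap

    ∖-isHeap : IsHeap k (h ∖ a)
    ∖-isHeap = record
      { lab≥1 = lab≥1 ∘ punchIn a
      ; refl≤ = refl≤ ∘ punchIn a
      ; antisym = λ i j i≤j j≤i → punchIn-injective a i j (antisym _ _ i≤j j≤i)
      ; trans≤ = λ i j l → trans≤ _ _ _
      ; A1 = λ i j → A1 _ _
      ; A2 = λ i j → A2 _ _ ∘ covers-punchIn }
      where
        covers-punchIn : ∀ {i j} → Covers (h ∖ a) i j → Covers h (punchIn a i) (punchIn a j)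
        covers-punchIn {i} {j} (i≤j , i≢j , between) = i≤j , i≢j ∘ punchIn-injective a i j , between′
          where
            between′ : ∀ g → le h (punchIn a i) g ≡ true → le h g (punchIn a j) ≡ true → g ≡ punchIn a i ⊎ g ≡ punchIn a j
            between′ g i≤g g≤j with punchIn-view a g
            ... | inj₁ refl = contradiction (a-max _ g≤j) (punchInᵢ≢i a j)
            ... | inj₂ (g′ , refl) = Sum.map (cong (punchIn a)) (cong (punchIn a)) (between g′ i≤g g≤j)

    module Restore (w′ : List ℕ) (φ : (h ∖ a) ≅ heapOf w′) where

      toWord : Fin (suc n) → Fin (length (lab h a ∷ w′))
      toWord x with x Fin.≟ a
      ... | yes _   = zero
      ... | no  x≢a = suc (to φ (punchOut (x≢a ∘ sym)))

      fromWord : Fin (length (lab h a ∷ w′)) → Fin (suc n)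
      fromWord zero    = a
      fromWord (suc y) = punchIn a (from φ y)

      toWord-a : toWord a ≡ zero
      toWord-a with a Fin.≟ a
      ... | yes _   = refl
      ... | no  a≢a = contradiction refl a≢a

      toWord-punchIn : ∀ x′ → toWord (punchIn a x′) ≡ suc (to φ x′)
      toWord-punchIn x′ with punchIn a x′ Fin.≟ a
      ... | yes x≡a = contradiction x≡a (punchInᵢ≢i a x′)
      ... | no  x≢a = cong (suc ∘ to φ) (trans (punchOut-cong a refl) (punchOut-punchIn a))

      a-not-below : ∀ x′ → le h a (punchIn a x′) ≡ false
      a-not-below x′ = ¬-not (λ a≤x → punchInᵢ≢i a x′ (a-max _ a≤x))

      -- x lies below the maximal piece a iff it lies below a piece concurrent with a: one direction
      -- through a cover of a (A2), the other by A1 and the maximality of a.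
      below-a : ∀ x′ → below (lab h a ∷ w′) (suc (to φ x′)) zero ≡ le h (punchIn a x′) a
      below-a x′ = Bool-ext via-word via-cover
        where
          via-word : below (lab h a ∷ w′) (suc (to φ x′)) zero ≡ true → le h (punchIn a x′) a ≡ true
          via-word x≤a with below-top⁻ (lab h a) w′ (to φ x′) x≤a
          ... | l , x≤l , l~a with A1 (punchIn a (from φ l)) a (subst (λ b → Conc k b (lab h a)) (sym (lab-from φ l)) l~a)
          ...   | inj₁ l≤a =
            trans≤ _ _ _ (trans (sym (le-to φ x′ (from φ l))) (trans (cong (below w′ (to φ x′)) (to-from φ l)) x≤l)) l≤a
          ...   | inj₂ a≤l = contradiction (a-max _ a≤l) (punchInᵢ≢i a _)
          via-cover : le h (punchIn a x′) a ≡ true → below (lab h a ∷ w′) (suc (to φ x′)) zero ≡ true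
          via-cover x≤a with covered-below h-heap (punchIn a x′) a x≤a (punchInᵢ≢i a x′)
          ... | g , x≤g , g⋖a with punchIn-view a g
          ...   | inj₁ refl = contradiction refl (proj₁ (proj₂ g⋖a))
          ...   | inj₂ (g′ , refl) = below-top⁺ (lab h a) w′ (to φ x′) (to φ g′) (trans (le-to φ x′ g′) x≤g)
                                       (subst (λ b → Conc k b (lab h a)) (sym (lab-to φ g′)) (A2 _ _ g⋖a))

      iso : h ≅ heapOf (lab h a ∷ w′)
      iso = record { to = toWord ; from = fromWord ; to-from = to-from′ ; from-to = from-to′ ; lab-to = lab-to′ ; le-to = le-to′ }
        where
          to-from′ : ∀ y → toWord (fromWord y) ≡ y
          to-from′ zero    = toWord-a
          to-from′ (suc y) = trans (toWord-punchIn (from φ y)) (cong suc (to-from φ y))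
          from-to′ : ∀ x → fromWord (toWord x) ≡ x
          from-to′ x with punchIn-view a x
          ... | inj₁ refl rewrite toWord-a = refl
          ... | inj₂ (x′ , refl) rewrite toWord-punchIn x′ = cong (punchIn a) (from-to φ x′)
          lab-to′ : ∀ x → lookup (lab h a ∷ w′) (toWord x) ≡ lab h x
          lab-to′ x with punchIn-view a x
          ... | inj₁ refl rewrite toWord-a = refl
          ... | inj₂ (x′ , refl) rewrite toWord-punchIn x′ = lab-to φ x′
          le-to′ : ∀ x y → below (lab h a ∷ w′) (toWord x) (toWord y) ≡ le h x y
          le-to′ x y with punchIn-view a x | punchIn-view a y
          ... | inj₁ refl | inj₁ refl rewrite toWord-a = sym (refl≤ a)
          ... | inj₁ refl | inj₂ (y′ , refl) rewrite toWord-a | toWord-punchIn y′ = sym (a-not-below y′)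
          ... | inj₂ (x′ , refl) | inj₂ (y′ , refl) rewrite toWord-punchIn x′ | toWord-punchIn y′ = le-to φ x′ y′
          ... | inj₂ (x′ , refl) | inj₁ refl rewrite toWord-a | toWord-punchIn x′ = below-a x′

  record DownsetSplit {n} (h : LPoset n) (D : Fin n → Bool) : Set where
    field
      upper lower : List ℕ
      iso         : h ≅ heapOf (upper ++ lower)
      D⇒lower     : ∀ x → D x ≡ true → ∃[ j ] to iso x ≡ inR upper lower j
      ¬D⇒upper    : ∀ x → D x ≡ false → ∃[ i ] to iso x ≡ inL upper lower i
      sum≡weight  : sum (upper ++ lower) ≡ weight h

  DownClosed : ∀ {n} → LPoset n → (Fin n → Bool) → Set
  DownClosed h D = ∀ x y → le h x y ≡ true → D y ≡ true → D x ≡ true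

  maximal-outside : ∀ {n} {h : LPoset n} → IsHeap k h → (D : Fin n → Bool) → DownClosed h D →
    ∀ x → D x ≡ false → ∃[ a ] Maximal h a × D a ≡ false
  maximal-outside {h = h} h-heap D closed x x∉D
    with maximalIn-exists (le h) (IsHeap.antisym h-heap) (IsHeap.trans≤ h-heap) (λ x → D x Bool.≟ false) x x∉D
  ... | a , a∉D , a-max-in = a , a-max , a∉D
    where
      a-max : Maximal h a
      a-max b a≤b with D b in b∈D
      ... | true  = contradiction (trans (sym (closed a b a≤b b∈D)) a∉D) λ ()
      ... | false = a-max-in b b∈D a≤b

  preferred-maximal : ∀ {n} {h : LPoset (suc n)} → IsHeap k h → (D : Fin (suc n) → Bool) → DownClosed h D →
    ∃[ a ] Maximal h a × (D a ≡ true → ∀ x → D x ≡ true)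
  preferred-maximal h-heap D closed with any? (λ x → D x Bool.≟ false)
  ... | yes (x , x∉D) with maximal-outside h-heap D closed x x∉D
  ...   | a , a-max , a∉D = a , a-max , λ a∈D → contradiction (trans (sym a∉D) a∈D) false≢true
  preferred-maximal h-heap D closed | no ∄x∉D with maximal-above h-heap zero
  ...   | a , _ , a-max = a , a-max , λ _ x → ¬-not (λ x∉D → ∄x∉D (x , x∉D))

  downset-split-step : ∀ {n} {h : LPoset (suc n)} (h-heap : IsHeap k h) (D : Fin (suc n) → Bool) a (a-max : Maximal h a) →
    (D a ≡ true → ∀ x → D x ≡ true) → DownsetSplit (h ∖ a) (D ∘ punchIn a) → DownsetSplit h D
  downset-split-step {n} {h} h-heap D a a-max pref rest with D a in a∈D
  ... | false = record
    { upper = lab h a ∷ upper′ ; lower = lower′ ; iso = iso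
    ; D⇒lower = λ x x∈D → D⇒lower x x∈D (punchIn-view a x)
    ; ¬D⇒upper = λ x x∉D → ¬D⇒upper x x∉D (punchIn-view a x)
    ; sum≡weight = trans (cong (lab h a +_) sum≡weight′) (sym (weight-∖ h a)) }
    where
      open DownsetSplit rest renaming (upper to upper′; lower to lower′; iso to φ; D⇒lower to D⇒lower′;
                                       ¬D⇒upper to ¬D⇒upper′; sum≡weight to sum≡weight′)
      open Restore h-heap a a-max (upper′ ++ lower′) φ
      D⇒lower : ∀ x → D x ≡ true → x ≡ a ⊎ ∃[ x′ ] x ≡ punchIn a x′ →
        ∃[ j ] toWord x ≡ inR (lab h a ∷ upper′) lower′ j
      D⇒lower x x∈D (inj₁ refl) = contradiction (trans (sym a∈D) x∈D) false≢true
      D⇒lower x x∈D (inj₂ (x′ , refl)) with D⇒lower′ x′ x∈D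
      ... | j , e = j , trans (toWord-punchIn x′) (cong suc e)
      ¬D⇒upper : ∀ x → D x ≡ false → x ≡ a ⊎ ∃[ x′ ] x ≡ punchIn a x′ →
        ∃[ i ] toWord x ≡ inL (lab h a ∷ upper′) lower′ i
      ¬D⇒upper x _ (inj₁ refl) = zero , toWord-a
      ¬D⇒upper x x∉D (inj₂ (x′ , refl)) with ¬D⇒upper′ x′ x∉D
      ... | i , e = suc i , trans (toWord-punchIn x′) (cong suc e)
  ... | true = record
    { upper = [] ; lower = lab h a ∷ (upper′ ++ lower′) ; iso = iso
    ; D⇒lower = λ x _ → to iso x , refl
    ; ¬D⇒upper = λ x x∉D → contradiction (trans (sym x∉D) (pref refl x)) λ ()
    ; sum≡weight = trans (cong (lab h a +_) sum≡weight′) (sym (weight-∖ h a)) }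
    where
      open DownsetSplit rest renaming (upper to upper′; lower to lower′; iso to φ; sum≡weight to sum≡weight′)
      open Restore h-heap a a-max (upper′ ++ lower′) φ

  downset-split : ∀ {n} {h : LPoset n} → IsHeap k h → (D : Fin n → Bool) → DownClosed h D → DownsetSplit h D
  downset-split {zero} {h} _ D _ = record
    { upper = [] ; lower = [] ; iso = ≅-empty h ; D⇒lower = λ () ; ¬D⇒upper = λ () ; sum≡weight = refl }
  downset-split {suc n} {h} h-heap D closed with preferred-maximal h-heap D closed
  ... | a , a-max , pref = downset-split-step h-heap D a a-max pref
          (downset-split (∖-isHeap h-heap a a-max) (D ∘ punchIn a) (λ x y → closed _ _))

  -- Heaps all of whose maximal pieces have abscissa at most r + 1: for r > 0, one with maxima at
  -- most r with a pyramid of P, shifted by r, stacked on top.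
  boundedW : Family → ℕ → Family
  boundedW P r = prodW r (λ i → scaleW i P)

  -- Pyramids with fewer than f pieces: the top piece 1 dropped on a heap with maxima at most k + 1.
  pyramidsF : ℕ → Family
  pyramidsF zero    n       m       = []
  pyramidsF (suc f) zero    zero    = [] ∷ []
  pyramidsF (suc f) zero    (suc m) = []
  pyramidsF (suc f) (suc n) zero    = []
  pyramidsF (suc f) (suc n) (suc m) = map (1 ∷_) (boundedW (pyramidsF f) k n m)

  pyramids : Family
  pyramids n m = pyramidsF (suc n) n m

  counts-pyramidsF : ∀ f n m → counts (pyramidsF (suc f)) (suc n) (suc m) ≡ prodS k (λ i → scaleS i (counts (pyramidsF f))) n m
  counts-pyramidsF f n m =
    trans (length-map (1 ∷_) (boundedW (pyramidsF f) k n m))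
          (trans (counts-prodW k (λ i → scaleW i (pyramidsF f)) n m)
                 (prodS-cong-≤ k n m λ i a b _ → counts-scaleW i (pyramidsF f) a b))

  counts-pyramidsF-fuel : ∀ f f′ a b → a < f → a < f′ → counts (pyramidsF f) a b ≡ counts (pyramidsF f′) a b
  counts-pyramidsF-fuel (suc f) (suc f′) zero    zero    _ _ = refl
  counts-pyramidsF-fuel (suc f) (suc f′) zero    (suc b) _ _ = refl
  counts-pyramidsF-fuel (suc f) (suc f′) (suc a) zero    _ _ = refl
  counts-pyramidsF-fuel (suc f) (suc f′) (suc a) (suc b) (s≤s a<f) (s≤s a<f′) =
    trans (counts-pyramidsF f a b) (trans (prodS-cong-≤ k a b λ i a′ b′ a′≤a → scaleS-cong-≤ i a′ b′ λ b″ →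
      counts-pyramidsF-fuel f f′ a′ b″ (<-≤-trans (s≤s a′≤a) a<f) (<-≤-trans (s≤s a′≤a) a<f′))
      (sym (counts-pyramidsF f′ a b)))

  counts-pyramids-recurrence : ∀ n m → counts pyramids n m ≡ (oneS ⊕ pxS (prodS k (λ j → scaleS j (counts pyramids)))) n m
  counts-pyramids-recurrence zero    zero    = refl
  counts-pyramids-recurrence zero    (suc m) = refl
  counts-pyramids-recurrence (suc n) zero    = refl
  counts-pyramids-recurrence (suc n) (suc m) =
    trans (counts-pyramidsF (suc n) n m) (prodS-cong-≤ k n m λ i a b a≤n → scaleS-cong-≤ i a b λ b′ →
      counts-pyramidsF-fuel (suc n) (suc a) a b′ (s≤s a≤n) ≤-refl)

  IsPyramid : List ℕ → Set
  IsPyramid []      = ⊤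
  IsPyramid (c ∷ w) = c ≡ 1 × (∀ x → below (c ∷ w) x zero ≡ true)

  Bounded : ℕ → List ℕ → Set
  Bounded r w = ∀ x → downsetᵇ (heapOf w) r x ≡ true

  record Graded (n m : ℕ) (w : List ℕ) : Set where
    field
      length≡  : length w ≡ n
      sum≡     : sum w ≡ m
      positive : All (1 ≤_) w

  PyramidWord : ℕ → ℕ → List ℕ → Set
  PyramidWord n m w = Graded n m w × IsPyramid w

  BoundedWord : ℕ → ℕ → ℕ → List ℕ → Set
  BoundedWord r n m w = Graded n m w × Bounded (suc r) w

  downset-inL : ∀ u v r i → downsetᵇ (heapOf u) r i ≡ true → downsetᵇ (heapOf (u ++ v)) r (inL u v i) ≡ true
  downset-inL u v r i i∈D with downset⁻ (heapOf u) r i i∈D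
  ... | y , i≤y , y≤r =
    downset⁺ (heapOf (u ++ v)) r _ (inL u v y) (trans (below-LL u v i y) i≤y) (subst (_≤ r) (sym (lookup-inL u v y)) y≤r)

  downset-inR : ∀ u v r j → downsetᵇ (heapOf v) r j ≡ true → downsetᵇ (heapOf (u ++ v)) r (inR u v j) ≡ true
  downset-inR u v r j j∈D with downset⁻ (heapOf v) r j j∈D
  ... | y , j≤y , y≤r =
    downset⁺ (heapOf (u ++ v)) r _ (inR u v y) (trans (below-RR u v j y) j≤y) (subst (_≤ r) (sym (lookup-inR u v y)) y≤r)

  downset-mono : ∀ w {r r′} → r ≤ r′ → ∀ x → downsetᵇ (heapOf w) r x ≡ true → downsetᵇ (heapOf w) r′ x ≡ true
  downset-mono w r≤r′ x x∈D with downset⁻ (heapOf w) _ x x∈D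
  ... | y , x≤y , y≤r = downset⁺ (heapOf w) _ x y x≤y (≤-trans y≤r r≤r′)

  shift-pyramid-bounded : ∀ r y → IsPyramid y → Bounded (suc r) (shift r y)
  shift-pyramid-bounded r (c ∷ y) (refl , all≤top) x =
    downset⁺ (heapOf (shift r (1 ∷ y))) (suc r) x zero x≤top (≤-reflexive (+-comm r 1))
    where
      x≤top : below (shift r (1 ∷ y)) x zero ≡ true
      x≤top = begin
        below (shift r (1 ∷ y)) x zero ≡⟨ cong₂ (below (shift r (1 ∷ y))) (sym (mapIx-unmapIx (r +_) (1 ∷ y) x)) refl ⟩
        below (shift r (1 ∷ y)) (mapIx (r +_) (1 ∷ y) (unmapIx (r +_) (1 ∷ y) x)) zero
          ≡⟨ below-mapIx (r +_) (conc-shift⁺ r) (conc-shift⁻ r) (1 ∷ y) (unmapIx (r +_) (1 ∷ y) x) zero ⟩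
        below (1 ∷ y) (unmapIx (r +_) (1 ∷ y) x) zero ≡⟨ all≤top (unmapIx (r +_) (1 ∷ y) x) ⟩
        true ∎
        where open ≡-Reasoning

  sum-shift : ∀ j y → sum (shift j y) ≡ j * length y + sum y
  sum-shift j []      = sym (cong (_+ 0) (*-zeroʳ j))
  sum-shift j (c ∷ y) = trans (cong (j + c +_) (sum-shift j y)) (rearrange j c (length y) (sum y))
    where
      rearrange : ∀ j c l s → j + c + (j * l + s) ≡ j * suc l + (c + s)
      rearrange = solve-∀

  length-stack : ∀ r y v → length (shift r y ++ v) ≡ length y + length v
  length-stack r y v = trans (length-++ (shift r y)) (cong (_+ length v) (length-map (r +_) y))

  sum-stack : ∀ r y v → sum (shift r y ++ v) ≡ r * length y + sum y + sum v
  sum-stack r y v = trans (sum-++ (shift r y) v) (cong (_+ sum v) (sum-shift r y))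

  graded-scaleW : ∀ j P n m → (∀ {y} → y ∈ P n (m ∸ j * n) → Graded n (m ∸ j * n) y) →
    ∀ {x} → x ∈ scaleW j P n m → Graded n m x
  graded-scaleW j P n m graded x∈ with ∈-scaleW⁻ j P n m x∈
  ... | jn≤m , y , y∈ , refl = record
    { length≡ = trans (length-map (j +_) y) length≡
    ; sum≡ = trans (sum-shift j y) (trans (cong₂ (λ l s → j * l + s) length≡ sum≡) (m+[n∸m]≡n jn≤m))
    ; positive = All.map⁺ (All.map (λ {c} 1≤c → ≤-trans 1≤c (m≤n+m c j)) positive) }
    where open Graded (graded y∈)

  graded-++ : ∀ {n n′ m m′ u v} → Graded n m u → Graded n′ m′ v → Graded (n + n′) (m + m′) (u ++ v)
  graded-++ {u = u} {v} gu gv = record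
    { length≡ = trans (length-++ u) (cong₂ _+_ (length≡ gu) (length≡ gv))
    ; sum≡ = trans (sum-++ u v) (cong₂ _+_ (sum≡ gu) (sum≡ gv))
    ; positive = All.++⁺ (positive gu) (positive gv) }
    where open Graded

  module _ (P : Family) (P-pyramids : ∀ {a b y} → y ∈ P a b → PyramidWord a b y) where

    boundedW-words : ∀ r n m {x} → x ∈ boundedW P r n m → BoundedWord r n m x
    boundedW-words zero n m x∈ with ∈-scaleW⁻ 0 P n m x∈
    ... | _ , y , y∈ , refl = graded-scaleW 0 P n m (proj₁ ∘ P-pyramids) x∈ , shift-pyramid-bounded 0 y (proj₂ (P-pyramids y∈))
    boundedW-words (suc r) n m {x} x∈ with ∈-mulW⁻ (boundedW P r) (scaleW (suc r) P) n m x∈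
    ... | record { a = a ; b = b ; a≤n = a≤n ; b≤m = b≤m ; bottom = bottom ; bottom∈ = bottom∈ ; top∈ = top∈ ; x≡ = refl }
      with boundedW-words r a b bottom∈ | ∈-scaleW⁻ (suc r) P (n ∸ a) (m ∸ b) top∈
    ...   | bottom-graded , bottom-bounded | _ , y , y∈ , refl =
      subst₂ (λ n m → Graded n m x) (m∸n+n≡m a≤n) (m∸n+n≡m b≤m) (graded-++ top-graded bottom-graded) , bounded
      where
        top-graded : Graded (n ∸ a) (m ∸ b) (shift (suc r) y)
        top-graded = graded-scaleW (suc r) P (n ∸ a) (m ∸ b) (proj₁ ∘ P-pyramids) top∈
        bounded : Bounded (suc (suc r)) (shift (suc r) y ++ bottom)
        bounded z with side++ (shift (suc r) y) bottom z
        ... | left i  = downset-inL (shift (suc r) y) bottom (suc (suc r)) i (shift-pyramid-bounded (suc r) y (proj₂ (P-pyramids y∈)) i)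
        ... | right j = downset-inR (shift (suc r) y) bottom (suc (suc r)) j (downset-mono bottom (n≤1+n _) j (bottom-bounded j))

  pyramidsF-words : ∀ f n m {y} → y ∈ pyramidsF f n m → PyramidWord n m y
  pyramidsF-words (suc f) zero    zero    (here refl) = record { length≡ = refl ; sum≡ = refl ; positive = [] } , tt
  pyramidsF-words (suc f) (suc n) (suc m) y∈ with ∈-map⁻ (1 ∷_) y∈
  ... | t , t∈ , refl with boundedW-words (pyramidsF f) (pyramidsF-words f _ _) k n m t∈
  ...   | t-graded , t-bounded =
    record { length≡ = cong suc length≡ ; sum≡ = cong suc sum≡ ; positive = s≤s z≤n ∷ positive } , refl , below-top
    where
      open Graded t-graded
      below-top : ∀ x → below (1 ∷ t) x zero ≡ true
      below-top zero    = refl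
      below-top (suc x) with downset⁻ (heapOf t) (suc k) x (t-bounded x)
      ... | y , x≤y , y≤1+k = below-top⁺ 1 t x y x≤y (y≤1+k , ≤-trans (All.lookup positive (∈-lookup y)) (m≤m+n _ k))

  top-maximal : ∀ c w → Maximal (heapOf (c ∷ w)) zero
  top-maximal c w zero _ = refl

  pyramid-maximal : ∀ c w → IsPyramid (c ∷ w) → ∀ b → Maximal (heapOf (c ∷ w)) b → b ≡ zero
  pyramid-maximal c w (_ , all≤top) b b-max = sym (b-max zero (all≤top b))

  pyramid-counted : ∀ w → IsPyramid w → Counted (heapOf w)
  pyramid-counted []      _   = inj₁ refl
  pyramid-counted (c ∷ w) pyr = inj₂ (zero , top-maximal c w , proj₁ pyr , pyramid-maximal c w pyr)

  shift-above : ∀ r {y} → All (1 ≤_) y → All (r <_) (shift r y)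
  shift-above r y≥1 = All.map⁺ (All.map (λ {c} 1≤c → subst (_≤ r + c) (+-comm r 1) (+-monoʳ-≤ r 1≤c)) y≥1)

  upper-outside-downset : ∀ r u v → All (r <_) u → ∀ i → downsetᵇ (heapOf (u ++ v)) r (inL u v i) ≡ false
  upper-outside-downset r u v u>r i = ¬-not outside
    where
      outside : downsetᵇ (heapOf (u ++ v)) r (inL u v i) ≢ true
      outside i∈D with downset⁻ (heapOf (u ++ v)) r (inL u v i) i∈D
      ... | y , i≤y , y≤r with side++ u v y
      ...   | left i′  = <⇒≱ (All.lookup u>r (∈-lookup i′)) (subst (_≤ r) (lookup-inL u v i′) y≤r)
      ...   | right j  = contradiction (trans (sym (below-LR u v i j)) i≤y) false≢true

  -- An isomorphism preserves the downset of pieces below some piece of abscissa ≤ r, and in u ++ v that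
  -- downset is exactly the lower layer v; so the isomorphism respects the layers.
  layers-≅ : ∀ r u v u′ v′ → All (r <_) u → Bounded r v → All (r <_) u′ → Bounded r v′ →
    heapOf (u ++ v) ≅ heapOf (u′ ++ v′) → heapOf u ≅ heapOf u′ × heapOf v ≅ heapOf v′
  layers-≅ r u v u′ v′ u>r v≤r u′>r v′≤r φ =
    ≅-split u u′ v v′ φ (keeps-lower u v u′ v′ φ v≤r u′>r) (keeps-lower u′ v′ u v (≅-sym φ) v′≤r u>r)
    where
      keeps-lower : ∀ u v u′ v′ (ψ : heapOf (u ++ v) ≅ heapOf (u′ ++ v′)) → Bounded r v → All (r <_) u′ →
        ∀ j → ∃[ j′ ] to ψ (inR u v j) ≡ inR u′ v′ j′
      keeps-lower u v u′ v′ ψ v≤r u′>r j with inL-or-inR u′ v′ (to ψ (inR u v j))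
      ... | inj₂ (j′ , e) = j′ , e
      ... | inj₁ (i′ , e) = contradiction (begin
        true                                               ≡⟨ sym (downset-inR u v r j (v≤r j)) ⟩
        downsetᵇ (heapOf (u ++ v)) r (inR u v j)            ≡⟨ sym (downset-≅ ψ r (inR u v j)) ⟩
        downsetᵇ (heapOf (u′ ++ v′)) r (to ψ (inR u v j))   ≡⟨ cong (downsetᵇ (heapOf (u′ ++ v′)) r) e ⟩
        downsetᵇ (heapOf (u′ ++ v′)) r (inL u′ v′ i′)       ≡⟨ upper-outside-downset r u′ v′ u′>r i′ ⟩
        false                                              ∎) λ ()
        where open ≡-Reasoning

  ≅-top : ∀ c c′ t t′ (φ : heapOf (c ∷ t) ≅ heapOf (c′ ∷ t′)) → to φ zero ≡ zero → heapOf t ≅ heapOf t′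
  ≅-top c c′ t t′ φ top↦top = proj₂ (≅-split (c ∷ []) (c′ ∷ []) t t′ φ keeps-rest keeps-rest-sym)
    where
      keeps-rest : ∀ j → ∃[ j′ ] to φ (suc j) ≡ suc j′
      keeps-rest j with to φ (suc j) in e
      ... | zero   = contradiction (to-injective φ (trans e (sym top↦top))) λ ()
      ... | suc j′ = j′ , refl
      keeps-rest-sym : ∀ j′ → ∃[ j ] from φ (suc j′) ≡ suc j
      keeps-rest-sym j′ with from φ (suc j′) in e
      ... | zero   = contradiction (trans (sym (to-from φ (suc j′))) (trans (cong (to φ) e) top↦top)) λ ()
      ... | suc j  = j , refl

  record Layers (P : Family) (r n m : ℕ) (x : List ℕ) : Set where
    field
      {a b c}    : ℕ
      top bottom : List ℕ
      top∈       : top ∈ P (n ∸ a) c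
      bottom∈    : bottom ∈ boundedW P r a b
      x≡         : x ≡ shift (suc r) top ++ bottom

  ∈-boundedW-suc⁻ : ∀ P r n m {x} → x ∈ boundedW P (suc r) n m → Layers P r n m x
  ∈-boundedW-suc⁻ P r n m x∈ with ∈-mulW⁻ (boundedW P r) (scaleW (suc r) P) n m x∈
  ... | record { bottom∈ = bottom∈ ; top∈ = top∈ ; x≡ = x≡ } with ∈-scaleW⁻ (suc r) P _ _ top∈
  ...   | _ , y , y∈ , refl = record { top∈ = y∈ ; bottom∈ = bottom∈ ; x≡ = x≡ }

  module _ (P : Family) (P-pyramids : ∀ {a b y} → y ∈ P a b → PyramidWord a b y) where

    layers-of-boundedW : ∀ r {n m n′ m′ x x′} (L : Layers P r n m x) (L′ : Layers P r n′ m′ x′) → heapOf x ≅ heapOf x′ →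
      heapOf (Layers.top L) ≅ heapOf (Layers.top L′) × heapOf (Layers.bottom L) ≅ heapOf (Layers.bottom L′)
    layers-of-boundedW r L L′ φ =
      Product.map₁ (≅-unshift (suc r) top top′)
        (layers-≅ (suc r) (shift (suc r) top) bottom (shift (suc r) top′) bottom′
          (shift-above (suc r) (Graded.positive (proj₁ (P-pyramids top∈))))  (proj₂ (boundedW-words P P-pyramids r _ _ bottom∈))
          (shift-above (suc r) (Graded.positive (proj₁ (P-pyramids top∈′)))) (proj₂ (boundedW-words P P-pyramids r _ _ bottom∈′))
          (subst₂ (λ z z′ → heapOf z ≅ heapOf z′) x≡ x≡′ φ))
      where
        open Layers L
        open Layers L′ renaming (top to top′; bottom to bottom′; top∈ to top∈′; bottom∈ to bottom∈′; x≡ to x≡′)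

    module _ (P-injective : ∀ {a b a′ b′ y y′} → y ∈ P a b → y′ ∈ P a′ b′ → heapOf y ≅ heapOf y′ → y ≡ y′) where

      boundedW-≅-injective : ∀ r n m n′ m′ {x x′} → x ∈ boundedW P r n m → x′ ∈ boundedW P r n′ m′ →
        heapOf x ≅ heapOf x′ → x ≡ x′
      boundedW-≅-injective zero n m n′ m′ x∈ x′∈ φ with ∈-scaleW⁻ 0 P n m x∈ | ∈-scaleW⁻ 0 P n′ m′ x′∈
      ... | _ , y , y∈ , refl | _ , y′ , y′∈ , refl = cong (shift 0) (P-injective y∈ y′∈ (≅-unshift 0 y y′ φ))
      boundedW-≅-injective (suc r) n m n′ m′ x∈ x′∈ φ
        with ∈-boundedW-suc⁻ P r n m x∈ | ∈-boundedW-suc⁻ P r n′ m′ x′∈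
      ... | L | L′ with layers-of-boundedW r L L′ φ
      ...   | top≅ , bottom≅ =
        trans (Layers.x≡ L) (trans (cong₂ (λ y v → shift (suc r) y ++ v)
          (P-injective (Layers.top∈ L) (Layers.top∈ L′) top≅)
          (boundedW-≅-injective r _ _ _ _ (Layers.bottom∈ L) (Layers.bottom∈ L′) bottom≅)) (sym (Layers.x≡ L′)))

  ∈-pyramidsF⁻ : ∀ f n m {w} → w ∈ pyramidsF (suc f) n m →
    w ≡ [] ⊎ ∃[ n′ ] ∃[ m′ ] ∃[ t ] t ∈ boundedW (pyramidsF f) k n′ m′ × w ≡ 1 ∷ t
  ∈-pyramidsF⁻ f zero    zero    (here refl) = inj₁ refl
  ∈-pyramidsF⁻ f (suc n) (suc m) w∈ with ∈-map⁻ (1 ∷_) w∈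
  ... | t , t∈ , refl = inj₂ (n , m , t , t∈ , refl)

  pyramidsF-≅-injective : ∀ f n m n′ m′ {w w′} → w ∈ pyramidsF f n m → w′ ∈ pyramidsF f n′ m′ →
    heapOf w ≅ heapOf w′ → w ≡ w′
  pyramidsF-≅-injective (suc f) n m n′ m′ w∈ w′∈ φ with ∈-pyramidsF⁻ f n m w∈ | ∈-pyramidsF⁻ f n′ m′ w′∈
  ... | inj₁ refl | inj₁ refl = refl
  ... | inj₁ refl | inj₂ (_ , _ , _ , _ , refl) = contradiction (≅-size φ) λ ()
  ... | inj₂ (_ , _ , _ , _ , refl) | inj₁ refl = contradiction (≅-size φ) λ ()
  ... | inj₂ (a , b , t , t∈ , refl) | inj₂ (a′ , b′ , t′ , t′∈ , refl) =
    cong (1 ∷_) (boundedW-≅-injective (pyramidsF f) (pyramidsF-words f _ _) (pyramidsF-≅-injective f _ _ _ _) k a b a′ b′ t∈ t′∈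
      (≅-top 1 1 t t′ φ (pyramid-maximal 1 t′ (proj₂ (pyramidsF-words (suc f) n′ m′ w′∈)) (to φ zero)
                                           (maximal-≅ φ zero (top-maximal 1 t)))))

  module _ (P : Family) (P-pyramids : ∀ {a b y} → y ∈ P a b → PyramidWord a b y) (P-unique : ∀ a b → Unique (P a b)) where

    Unique-boundedW : ∀ r n m → Unique (boundedW P r n m)
    Unique-boundedW zero    n m = Unique-scaleW 0 P n m (P-unique _ _)
    Unique-boundedW (suc r) n m =
      Unique-mulW (boundedW P r) (scaleW (suc r) P) n m (Unique-boundedW r) (λ a b → Unique-scaleW (suc r) P a b (P-unique _ _))
        (λ a b u∈ → Graded.length≡ (graded-scaleW (suc r) P a b (proj₁ ∘ P-pyramids) u∈)) split-unique
      where
        -- The top layers of two splittings of one word are isomorphic, hence of equal length.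
        top-lengths : ∀ {a b c a′ b′ c′ y v y′ v′} → y ∈ P (n ∸ a) c → v ∈ boundedW P r a b →
          y′ ∈ P (n ∸ a′) c′ → v′ ∈ boundedW P r a′ b′ →
          shift (suc r) y ++ v ≡ shift (suc r) y′ ++ v′ → length (shift (suc r) y) ≡ length (shift (suc r) y′)
        top-lengths {y = y} {v} {y′} {v′} y∈ v∈ y′∈ v′∈ e =
          trans (length-map _ y) (trans (≅-size (proj₁ (layers-of-boundedW P P-pyramids r L L′ φ))) (sym (length-map _ y′)))
          where
            L : Layers P r n m (shift (suc r) y ++ v)
            L = record { top∈ = y∈ ; bottom∈ = v∈ ; x≡ = refl }
            L′ : Layers P r n m (shift (suc r) y′ ++ v′)
            L′ = record { top∈ = y′∈ ; bottom∈ = v′∈ ; x≡ = refl }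
            φ : heapOf (shift (suc r) y ++ v) ≅ heapOf (shift (suc r) y′ ++ v′)
            φ = subst (λ z → heapOf (shift (suc r) y ++ v) ≅ heapOf z) e ≅-refl
        split-unique : ∀ {a b a′ b′ u v u′ v′} → v ∈ boundedW P r a b → u ∈ scaleW (suc r) P (n ∸ a) (m ∸ b) →
          v′ ∈ boundedW P r a′ b′ → u′ ∈ scaleW (suc r) P (n ∸ a′) (m ∸ b′) → u ++ v ≡ u′ ++ v′ → a ≡ a′ × b ≡ b′
        split-unique {a} {b} {a′} {b′} v∈ u∈ v′∈ u′∈ e
          with ∈-scaleW⁻ (suc r) P (n ∸ a) (m ∸ b) u∈ | ∈-scaleW⁻ (suc r) P (n ∸ a′) (m ∸ b′) u′∈
        ... | _ , y , y∈ , refl | _ , y′ , y′∈ , refl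
          with ++-injective (shift (suc r) y) (shift (suc r) y′) (top-lengths y∈ v∈ y′∈ v′∈ e) e
        ...   | _ , refl = trans (sym (Graded.length≡ (v-graded v∈))) (Graded.length≡ (v-graded v′∈)) ,
                           trans (sym (Graded.sum≡ (v-graded v∈))) (Graded.sum≡ (v-graded v′∈))
          where
            v-graded : ∀ {a b v} → v ∈ boundedW P r a b → Graded a b v
            v-graded v∈ = proj₁ (boundedW-words P P-pyramids r _ _ v∈)

  Unique-pyramidsF : ∀ f n m → Unique (pyramidsF f n m)
  Unique-pyramidsF zero    n       m       = []
  Unique-pyramidsF (suc f) zero    zero    = [] ∷ []
  Unique-pyramidsF (suc f) zero    (suc m) = []
  Unique-pyramidsF (suc f) (suc n) zero    = []
  Unique-pyramidsF (suc f) (suc n) (suc m) =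
    Unique.map⁺ ∷-injectiveʳ (Unique-boundedW (pyramidsF f) (pyramidsF-words f _ _) (Unique-pyramidsF f) k n m)

  weight-heapOf : ∀ w → weight (heapOf w) ≡ sum w
  weight-heapOf []      = refl
  weight-heapOf (c ∷ w) = cong (c +_) (weight-heapOf w)

  ≅-positive : ∀ {n} {h : LPoset n} → IsHeap k h → ∀ w → h ≅ heapOf w → All (1 ≤_) w
  ≅-positive h-heap w φ = All-fromLookup w λ i → subst (1 ≤_) (lab-from φ i) (IsHeap.lab≥1 h-heap (from φ i))

  upper-maximal : ∀ u v i → Maximal (heapOf u) i → Maximal (heapOf (u ++ v)) (inL u v i)
  upper-maximal u v i i-max y i≤y with side++ u v y
  ... | left i′  = cong (inL u v) (i-max i′ (trans (sym (below-LL u v i i′)) i≤y))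
  ... | right j  = contradiction (trans (sym (below-LR u v i j)) i≤y) false≢true

  maximal-shift : ∀ s w i → Maximal (heapOf w) i → Maximal (heapOf (shift s w)) (mapIx (s +_) w i)
  maximal-shift s w = maximal-≅ (≅-sym (heapOf-map (s +_) (conc-shift⁺ s) (conc-shift⁻ s) w))

  shift-unshift : ∀ s u → All (s ≤_) u → shift s (map (_∸ s) u) ≡ u
  shift-unshift s u u≥s = trans (sym (map-∘ u)) (map-id-local (All.map m+[n∸m]≡n u≥s))

  ∈-boundedW-suc⁺ : ∀ P r {a b a′ c y v} → y ∈ P a′ c → v ∈ boundedW P r a b →
    shift (suc r) y ++ v ∈ boundedW P (suc r) (a′ + a) (suc r * a′ + c + b)
  ∈-boundedW-suc⁺ P r {a} {b} {a′} {c} {y} y∈ v∈ =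
    ∈-mulW⁺ (boundedW P r) (scaleW (suc r) P) (a′ + a) (suc r * a′ + c + b) (m≤n+m a a′) (m≤n+m b _) v∈
      (subst₂ (λ n m → shift (suc r) y ∈ scaleW (suc r) P n m) (sym (m+n∸n≡m a′ a)) (sym (m+n∸n≡m _ b))
        (∈-scaleW⁺ (suc r) P a′ (suc r * a′ + c) (m≤m+n _ c)
          (subst (λ m → y ∈ P a′ m) (sym (m+n∸m≡n (suc r * a′) c)) y∈)))

  heap-word : ∀ {n} {h : LPoset n} → IsHeap k h → ∃[ w ] h ≅ heapOf w × sum w ≡ weight h
  heap-word h-heap = upper ++ lower , iso , sum≡weight
    where open DownsetSplit (downset-split h-heap (λ _ → true) (λ _ _ _ → id))

  unshift-exists : ∀ s u → All (s <_) u → ∃[ u′ ] u ≡ shift s u′ × All (1 ≤_) u′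
  unshift-exists s u u>s =
    map (_∸ s) u , sym (shift-unshift s u (All.map <⇒≤ u>s)) , All.map⁺ (All.map m<n⇒0<n∸m u>s)

  top-counted : ∀ s u → All (1 ≤_) u → (∀ i → Maximal (heapOf (shift s u)) i → lookup (shift s u) i ≤ suc s) →
    Counted (heapOf u)
  top-counted s u u≥1 max≤1+s = counted-if-maxima-at-1 (heapOf-isHeap u u≥1) λ i i-max →
    +-cancelˡ-≤ s _ 1 (subst₂ _≤_ (lookup-mapIx (s +_) u i) (+-comm 1 s) (max≤1+s _ (maximal-shift s u i i-max)))

  module _ {n} {h : LPoset n} (h-heap : IsHeap k h) (s : ℕ) where
    open IsHeap h-heap

    downset-closed : DownClosed h (downsetᵇ h s)
    downset-closed x y x≤y y∈D with downset⁻ h s y y∈D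
    ... | z , y≤z , z≤s = downset⁺ h s x z (trans≤ x y z x≤y y≤z) z≤s

    open DownsetSplit (downset-split h-heap (downsetᵇ h s) downset-closed)

    lower-in-downset : ∀ x j → to iso x ≡ inR upper lower j → downsetᵇ h s x ≡ true
    lower-in-downset x j x↦j with downsetᵇ h s x in x∈D
    ... | true  = refl
    ... | false with ¬D⇒upper x x∈D
    ...   | i , x↦i = contradiction (trans (sym x↦i) x↦j) (inL≢inR upper lower i j)

    lower-maxima : ∀ j → Maximal (heapOf lower) j → lookup lower j ≤ s
    lower-maxima j j-max with downset⁻ h s x (lower-in-downset x j x↦j)
      where x = from iso (inR upper lower j)
            x↦j = to-from iso (inR upper lower j)
    ... | z , x≤z , z≤s with D⇒lower z (downset⁺ h s z z (refl≤ z) z≤s)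
    ...   | z′ , z↦z′ with j-max z′ (trans (sym (below-RR upper lower j z′))
                                (trans (cong₂ (below (upper ++ lower)) (sym (to-from iso _)) (sym z↦z′)) (trans (le-to iso _ z) x≤z)))
    ...     | refl =
      subst (_≤ s) (trans (sym (lab-to iso z)) (trans (cong (lookup (upper ++ lower)) z↦z′) (lookup-inR upper lower j))) z≤s

    upper-above : All (s <_) upper
    upper-above = All-fromLookup upper λ i → ≰⇒> λ i≤s →
      let x = from iso (inL upper lower i) in
      contradiction (trans (sym (to-from iso _)) (proj₂ (D⇒lower x (downset⁺ h s x x (refl≤ x)
        (subst (_≤ s) (sym (trans (lab-from iso _) (lookup-inL upper lower i))) i≤s)))))
        (inL≢inR upper lower i _)

    upper-maxima : ∀ {t} → (∀ x → Maximal h x → lab h x ≤ t) → ∀ i → Maximal (heapOf upper) i → lookup upper i ≤ t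
    upper-maxima max≤t i i-max = subst (_≤ _) (trans (lab-from iso _) (lookup-inL upper lower i))
      (max≤t _ (maximal-≅ (≅-sym iso) _ (upper-maximal upper lower i i-max)))

  PyramidsComplete : ℕ → Set
  PyramidsComplete f = ∀ {n} {h : LPoset n} → n < f → IsHeap k h → Counted h →
    ∃[ w ] w ∈ pyramidsF f n (weight h) × h ≅ heapOf w

  BoundedComplete : ℕ → ℕ → Set
  BoundedComplete f r = ∀ {n} {h : LPoset n} → n < f → IsHeap k h → (∀ x → Maximal h x → lab h x ≤ suc r) →
    ∃[ w ] w ∈ boundedW (pyramidsF f) r n (weight h) × h ≅ heapOf w

  module _ (f : ℕ) (pyramids-complete : PyramidsComplete f) where

    stack-complete : ∀ r → BoundedComplete f r → ∀ {n} {h : LPoset n} → n < f → IsHeap k h → ∀ u v →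
      (φ : h ≅ heapOf (u ++ v)) → sum (u ++ v) ≡ weight h → All (suc r <_) u →
      (∀ i → Maximal (heapOf u) i → lookup u i ≤ suc (suc r)) → (∀ j → Maximal (heapOf v) j → lookup v j ≤ suc r) →
      ∃[ w ] w ∈ boundedW (pyramidsF f) (suc r) n (weight h) × h ≅ heapOf w
    stack-complete r bounded-complete {n} {h} n<f h-heap u v φ sum≡weight u>r u-max v-max with unshift-exists (suc r) u u>r
    ... | y , refl , y≥1
      with pyramids-complete {h = heapOf y} (size< (m≤m+n (length y) (length v))) (heapOf-isHeap y y≥1) (top-counted (suc r) y y≥1 u-max)
         | bounded-complete {h = heapOf v} (size< (m≤n+m (length v) (length y))) (heapOf-isHeap v v≥1) v-max
      where
        size< : ∀ {l} → l ≤ length y + length v → l < f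
        size< l≤ = ≤-<-trans (subst (_ ≤_) (trans (sym (length-stack (suc r) y v)) (sym (≅-size φ))) l≤) n<f
        v≥1 : All (1 ≤_) v
        v≥1 = All.++⁻ʳ (shift (suc r) y) (≅-positive h-heap _ φ)
    ... | w-top , w-top∈ , φ-top | w-bottom , w-bottom∈ , φ-bottom =
      shift (suc r) w-top ++ w-bottom ,
      subst₂ (λ n m → shift (suc r) w-top ++ w-bottom ∈ boundedW (pyramidsF f) (suc r) n m)
        (trans (sym (length-stack (suc r) y v)) (sym (≅-size φ)))
        (trans (cong₂ (λ a b → suc r * length y + a + b) (weight-heapOf y) (weight-heapOf v))
               (trans (sym (sum-stack (suc r) y v)) sum≡weight))
        (∈-boundedW-suc⁺ (pyramidsF f) r w-top∈ w-bottom∈) ,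
      ≅-trans φ (≅-++ (shift (suc r) y) (shift (suc r) w-top) v w-bottom (≅-shift (suc r) y w-top φ-top) φ-bottom)

    boundedW-complete : ∀ r → BoundedComplete f r
    boundedW-complete zero {h = h} n<f h-heap max≤1 with pyramids-complete n<f h-heap (counted-if-maxima-at-1 h-heap max≤1)
    ... | w , w∈ , φ = shift 0 w , ∈-scaleW⁺ 0 (pyramidsF f) _ _ z≤n w∈ , subst (λ w′ → h ≅ heapOf w′) (sym (map-id w)) φ
    boundedW-complete (suc r) {h = h} n<f h-heap max≤ =
      stack-complete r (boundedW-complete r) n<f h-heap upper lower iso sum≡weight
        (upper-above h-heap (suc r)) (upper-maxima h-heap (suc r) max≤) (lower-maxima h-heap (suc r))
      where open DownsetSplit (downset-split h-heap (downsetᵇ h (suc r)) (downset-closed h-heap (suc r)))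

  pyramidsF-complete : ∀ f → PyramidsComplete f
  pyramidsF-complete (suc f) {zero}  {h} _ _ _ = [] , here refl , ≅-empty h
  pyramidsF-complete (suc f) {suc n} {h} (s≤s n<f) h-heap (inj₂ (a , a-max , a≡1 , unique))
    with heap-word (∖-isHeap h-heap a a-max)
  ... | w , ψ , sum≡weight with boundedW-complete f (pyramidsF-complete f) k (subst (_< f) (≅-size ψ) n<f)
                                  (heapOf-isHeap w (≅-positive (∖-isHeap h-heap a a-max) w ψ)) rest-maxima
    where
      open Restore h-heap a a-max w ψ
      rest-maxima : ∀ y → Maximal (heapOf w) y → lookup w y ≤ suc k
      rest-maxima y y-max with below-top⁻ (lab h a) w y (trans (sym (le-from iso (suc y) zero))
                                 (below-unique-maximal h-heap a unique (from iso (suc y))))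
      ... | l , y≤l , (l≤a+k , _) with y-max l y≤l
      ...   | refl = subst (λ c → lookup w l ≤ c + k) a≡1 l≤a+k
  ... | t , t∈ , φ =
    1 ∷ t ,
    subst (λ m → 1 ∷ t ∈ pyramidsF (suc f) (suc n) m) (trans (cong (_+ weight (h ∖ a)) (sym a≡1)) (sym (weight-∖ h a)))
      (∈-map⁺ (1 ∷_) (subst₂ (λ n m → t ∈ boundedW (pyramidsF f) k n m)
                       (sym (≅-size ψ)) (trans (weight-heapOf w) sum≡weight) t∈)) ,
    ≅-trans (Restore.iso h-heap a a-max w ψ) (subst (λ c → heapOf (c ∷ w) ≅ heapOf (1 ∷ t)) (sym a≡1) (≅-∷ 1 w t φ))

  asHeap : ∀ {n} (w : List ℕ) → length w ≡ n → LPoset n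
  asHeap w refl = heapOf w

  heapOf-≅-asHeap : ∀ {n} (w : List ℕ) (p : length w ≡ n) → heapOf w ≅ asHeap w p
  heapOf-≅-asHeap w refl = ≅-refl

  asHeap-counted : ∀ {n m} (w : List ℕ) (p : length w ≡ n) → PyramidWord n m w →
    IsHeap k (asHeap w p) × Counted (asHeap w p) × weight (asHeap w p) ≡ m
  asHeap-counted w refl (w-graded , w-pyramid) =
    heapOf-isHeap w (Graded.positive w-graded) , pyramid-counted w w-pyramid , trans (weight-heapOf w) (Graded.sum≡ w-graded)

  module _ (n m : ℕ) where

    pyramid-length : ∀ i → length (lookup (pyramids n m) i) ≡ n
    pyramid-length i = Graded.length≡ (proj₁ (pyramidsF-words (suc n) n m (∈-lookup i)))

    pyramid-heaps : List (LPoset n)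
    pyramid-heaps = tabulate λ i → asHeap (lookup (pyramids n m) i) (pyramid-length i)

    length-pyramid-heaps : length pyramid-heaps ≡ counts pyramids n m
    length-pyramid-heaps = length-tabulate _

    heapOf-≅-pyramid-heaps : ∀ i → heapOf (lookup (pyramids n m) i) ≅ lookup pyramid-heaps (Fin.cast (sym length-pyramid-heaps) i)
    heapOf-≅-pyramid-heaps i =
      subst (heapOf (lookup (pyramids n m) i) ≅_) (sym (lookup-tabulate _ i)) (heapOf-≅-asHeap (lookup (pyramids n m) i) (pyramid-length i))

    pyramid-heaps-RepSystem : RepSystem k n m pyramid-heaps
    pyramid-heaps-RepSystem = all-counted , irredundant , complete
      where
        all-counted : All (λ h → IsHeap k h × Counted h × weight h ≡ m) pyramid-heaps
        all-counted = All.tabulate⁺ λ i → asHeap-counted _ (pyramid-length i) (pyramidsF-words (suc n) n m (∈-lookup i))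
        index : Fin (length pyramid-heaps) → Fin (counts pyramids n m)
        index = Fin.cast length-pyramid-heaps
        index⁻¹ : ∀ i → Fin.cast (sym length-pyramid-heaps) (index i) ≡ i
        index⁻¹ = cast-involutive (sym length-pyramid-heaps) length-pyramid-heaps
        heapOf-≅-lookup : ∀ i → heapOf (lookup (pyramids n m) (index i)) ≅ lookup pyramid-heaps i
        heapOf-≅-lookup i = subst (λ j → heapOf (lookup (pyramids n m) (index i)) ≅ lookup pyramid-heaps j) (index⁻¹ i)
          (heapOf-≅-pyramid-heaps (index i))
        irredundant : ∀ i j → Iso (lookup pyramid-heaps i) (lookup pyramid-heaps j) → i ≡ j
        irredundant i j φ = trans (sym (index⁻¹ i)) (trans (cong (Fin.cast (sym length-pyramid-heaps)) same-index) (index⁻¹ j))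
          where
            same-index : index i ≡ index j
            same-index = Unique-lookup-injective (Unique-pyramidsF (suc n) n m)
              (pyramidsF-≅-injective (suc n) n m n m (∈-lookup (index i)) (∈-lookup (index j))
                (≅-trans (heapOf-≅-lookup i) (≅-trans (Iso⇒≅ φ) (≅-sym (heapOf-≅-lookup j)))))
        complete : ∀ h → IsHeap k h → Counted h → weight h ≡ m → ∃[ i ] Iso h (lookup pyramid-heaps i)
        complete h h-heap h-counted refl with pyramidsF-complete (suc n) ≤-refl h-heap h-counted
        ... | w , w∈ , φ = Fin.cast (sym length-pyramid-heaps) (Any.index w∈) ,
          ≅⇒Iso (≅-trans φ (subst (λ w′ → heapOf w′ ≅ lookup pyramid-heaps (Fin.cast (sym length-pyramid-heaps) (Any.index w∈)))
                              (sym (lookup-index w∈)) (heapOf-≅-pyramid-heaps (Any.index w∈))))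

-- The argument works for every k.
proposition5p12 : (k : ℕ) → 1 ≤ k →
    Σ FPS λ G → IsGenFun k G ×
      (∀ n m → G n m ≡ (oneS ⊕ pxS (prodS k (λ j → scaleS j G))) n m)
proposition5p12 k _ =
  counts (pyramids k) ,
  (λ n m → pyramid-heaps k n m , pyramid-heaps-RepSystem k n m , length-pyramid-heaps k n m) ,
  counts-pyramids-recurrence k
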